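{- For each integer $k\ge 3$ let $\sigma_k$ be the pattern $(k-1)(k-2)\cdots 2\,1\,(k+1)\,k\in S_{k+1}$ (so $\sigma_3=2143$, $\sigma_4=32154$), and let $$g_k(x)=\sum_{n\ge0}|S_n(123,\sigma_k)|\,x^n .$$ Then $g_3(x)=\dfrac{1-2x}{1-3x+x^2}$ (the generating function of the even-index Fibonacci numbers $1,1,2,5,13,34,\dots$), and for every $k\ge 4$, $$g_k(x)=\frac{1}{1-x\,g_{k-1}(x)}.$$ Consequently, as $k\to\infty$, $g_k(x)$ converges coefficientwise to the Catalan generating function $C(x)=\sum_{n\ge0}\frac{1}{n+1}\binom{2n}{n}x^n$, which satisfies $C(x)=\frac{1}{1-xC(x)}$.
   Context: $S_n$ is the set of permutations of $\{1,\dots,n\}$; $S_0$ contains only the empty permutation. A permutation $\pi$ contains a pattern $\gamma\in S_m$ if some subsequence of $\pi$ of length $m$ is order-isomorphic to $\gamma$; otherwise $\pi$ avoids $\gamma$. $S_n(\gamma_1,\dots,\gamma_r)$ is the set of permutations in $S_n$ avoiding every $\gamma_i$. -}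

module Defs where

open import Data.Nat using (ℕ; zero; suc; _+_; _∸_; _<ᵇ_; _≡ᵇ_; _≤_)
import Data.Nat as ℕ
open import Data.Nat.Combinatorics using (_C_)
open import Data.Nat.DivMod using (_/_)
open import Data.Integer as ℤ using (ℤ; +_; -[1+_])
open import Data.Fin as Fin using (Fin; toℕ)
open import Data.Vec using (Vec; lookup; tabulate; _∷_; [])
open import Data.List using (List; length)
import Data.List as L
open import Data.List.Membership.Propositional using (_∈_)
open import Data.List.Relation.Unary.Unique.Propositional using (Unique)
open import Data.Product using (Σ; _×_; ∃)
open import Data.Bool using (if_then_else_)
open import Relation.Nullary using (¬_)
open import Relation.Binary.PropositionalEquality using (_≡_)
open import Function.Bundles using (_⇔_)

-- Permutations of {1,…,n}, stored 0-based as vectors of Fin n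
-- (one-line notation: entry i is π(i+1) - 1).

IsPerm : {n : ℕ} → Vec (Fin n) n → Set
IsPerm {n} π = (i j : Fin n) → lookup π i ≡ lookup π j → i ≡ j

-- A pattern is given in one-line notation by its values (natural numbers);
-- only their relative order matters.
-- π contains γ : some subsequence of π (positions f 0 < f 1 < … < f (m-1))
-- is order-isomorphic to γ.
Contains : {n m : ℕ} → Vec (Fin n) n → Vec ℕ m → Set
Contains {n} {m} π γ =
  Σ (Fin m → Fin n) λ f →
    ((i j : Fin m) → i Fin.< j → f i Fin.< f j) ×
    ((i j : Fin m) →
       (toℕ (lookup π (f i)) ℕ.< toℕ (lookup π (f j))) ⇔ (lookup γ i ℕ.< lookup γ j))

Avoids : {n m : ℕ} → Vec (Fin n) n → Vec ℕ m → Set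
Avoids π γ = ¬ Contains π γ

p123 : Vec ℕ 3
p123 = 1 ∷ 2 ∷ 3 ∷ []

-- σ_k = (k-1)(k-2)…2 1 (k+1) k ∈ S_{k+1}; value at 0-based position i
σval : ℕ → ℕ → ℕ
σval k i = if (i + 1) <ᵇ k then k ∸ 1 ∸ i
           else (if (i + 1) ≡ᵇ k then suc k else k)

σ : (k : ℕ) → Vec ℕ (suc k)
σ k = tabulate (λ i → σval k (toℕ i))

InS : (k n : ℕ) → Vec (Fin n) n → Set
InS k n π = IsPerm π × Avoids π p123 × Avoids π (σ k)

HasSize : {A : Set} → (A → Set) → ℕ → Set
HasSize {A} P m =
  Σ (List A) λ xs → Unique xs × length xs ≡ m × ((x : A) → (x ∈ xs) ⇔ P x)

FPS : Set
FPS = ℕ → ℤ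

sumTo : (ℕ → ℤ) → ℕ → ℤ
sumTo f zero = f zero
sumTo f (suc n) = sumTo f n ℤ.+ f (suc n)

_⋆_ : FPS → FPS → FPS
(f ⋆ g) n = sumTo (λ i → f i ℤ.* g (n ∸ i)) n

_⊖_ : FPS → FPS → FPS
(f ⊖ g) n = f n ℤ.- g n

-- polynomial with given coefficient list (constant term first)
poly : List ℤ → FPS
poly L.[] n = + 0
poly (c L.∷ cs) zero = c
poly (c L.∷ cs) (suc n) = poly cs n

one : FPS
one = poly (+ 1 L.∷ L.[])

X : FPS
X = poly (+ 0 L.∷ + 1 L.∷ L.[])

catalan : ℕ → ℕ
catalan n = ((2 ℕ.* n) C n) / suc n

catalanGF : FPS
catalanGF n = + catalan n

-- Every permutation in S_{n+1}(123, σ_k) arises from exactly one permutation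
-- in S_n(123, σ_k) by inserting the new maximum into one of its n + 1 gaps.
-- Inserting at gap p creates 123 iff an ascent lies left of p, and creates σ_k
-- iff a descending run of length c = k − 1 lies left of p together with a
-- larger entry at or after p (the new maximum then plays k + 1).  Hence the
-- active gaps always form an initial segment 0, …, j − 1, and the number j of
-- active gaps obeys the succession rule: the empty permutation has label 1, and
--   (j) ↝ (j + 1) (c ⊓ 2) (c ⊓ 3) ⋯ (c ⊓ j).
-- So |S_n(123, σ_k)| is the number of nodes at depth n of this generating tree.
--
-- Raising the cap from c to c + 1 turns a node labelled j into one labelled
-- j + 1 whose children are those of j shifted up by one, plus one extra child
-- labelled 2.  Splitting by the generation at which that extra child is taken
-- gives g_k = 1 + x g_k g_{k−1}.  For c = 2 the depth-n counts below a label
-- 2 + i are affine in i, which yields a_{n+2} + a_n = 3 a_{n+1}.  When c > n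
-- the cap is never reached: the tree is the Catalan tree (j) ↝ (2)(3)⋯(j + 1),
-- whose counts are ballot numbers, and the same splitting gives C = 1 + x C².

module Submission where

open import Data.Nat
open import Data.Nat.Properties
open import Data.Nat.Combinatorics using (_C_; nCk+nC[k+1]≡[n+1]C[k+1]; nCk≡nC[n∸k]; nC1≡n)
open import Data.Nat.DivMod using (_/_; m*n/n≡m)
open import Data.Nat.ListAction using (sum)
open import Data.Nat.ListAction.Properties using (sum-++)
open import Data.Nat.Tactic.RingSolver using (solve-∀)
open import Data.Integer as ℤ using (ℤ)
import Data.Integer.Properties as ℤ
open import Data.Integer.Tactic.RingSolver using () renaming (solve-∀ to ℤ-solve-∀)
open import Data.Bool using (true; false; T)
open import Data.Bool.Properties using (T-≡)
open import Data.Fin as Fin using (Fin; toℕ; punchIn; punchOut; inject₁; fromℕ)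
open import Data.Fin.Properties as Fin using (toℕ<n)
open import Data.Fin.Patterns using (0F; 1F; 2F)
open import Data.Vec as Vec using (Vec; []; lookup; insertAt; tabulate)
import Data.Vec.Properties as Vecₚ
open import Data.List using (List; []; _∷_; [_]; _++_; map; concatMap; upTo; applyUpTo; length)
open import Data.List.Properties using (map-++; map-∘; map-cong; map-concatMap; length-map)
open import Data.List.Membership.Propositional using (_∈_; find; lose)
open import Data.List.Membership.Propositional.Properties
  using (∈-map⁺; ∈-map⁻; ∈-concatMap⁺; ∈-concatMap⁻; ∈-upTo⁺; ∈-upTo⁻)
open import Data.List.Relation.Unary.Any using (here; there)
open import Data.List.Relation.Unary.All as All using ([])
import Data.List.Relation.Unary.All.Properties as All
open import Data.List.Relation.Unary.AllPairs using ([]; _∷_)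
open import Data.List.Relation.Unary.Unique.Propositional using (Unique)
import Data.List.Relation.Unary.Unique.Propositional.Properties as Unique
open import Data.Product using (Σ; ∃; _×_; _,_; proj₁; proj₂)
open import Data.Sum using (_⊎_; inj₁; inj₂)
open import Data.Empty using (⊥; ⊥-elim)
open import Relation.Nullary using (¬_; yes; no)
open import Relation.Binary.PropositionalEquality hiding ([_])
open import Relation.Binary.Definitions using (tri<; tri≈; tri>)
open import Function using (_∘_)
open import Function.Bundles using (_⇔_; mk⇔; Equivalence)
open ≡-Reasoning

open import Defs

Σ< : ℕ → (ℕ → ℕ) → ℕ
Σ< zero    f = 0
Σ< (suc n) f = Σ< n f + f n

Σ<-cong : ∀ n {f g : ℕ → ℕ} → (∀ i → i < n → f i ≡ g i) → Σ< n f ≡ Σ< n g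
Σ<-cong zero    f≡g = refl
Σ<-cong (suc n) f≡g = cong₂ _+_ (Σ<-cong n (λ i i<n → f≡g i (m<n⇒m<1+n i<n))) (f≡g n ≤-refl)

Σ<-const : ∀ n x → Σ< n (λ _ → x) ≡ n * x
Σ<-const zero    x = refl
Σ<-const (suc n) x = trans (cong (_+ x) (Σ<-const n x)) (+-comm (n * x) x)

Σ<-distrib-+ : ∀ n (f g : ℕ → ℕ) → Σ< n (λ i → f i + g i) ≡ Σ< n f + Σ< n g
Σ<-distrib-+ zero    f g = refl
Σ<-distrib-+ (suc n) f g = begin
  Σ< n (λ i → f i + g i) + (f n + g n) ≡⟨ cong (_+ (f n + g n)) (Σ<-distrib-+ n f g) ⟩
  Σ< n f + Σ< n g + (f n + g n)        ≡⟨ +-interchange (Σ< n f) (Σ< n g) (f n) (g n) ⟩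
  Σ< n f + f n + (Σ< n g + g n)        ∎
  where
  +-interchange : ∀ a b c d → a + b + (c + d) ≡ a + c + (b + d)
  +-interchange = solve-∀

Σ<-distribʳ-* : ∀ n (f : ℕ → ℕ) x → Σ< n (λ i → f i * x) ≡ Σ< n f * x
Σ<-distribʳ-* zero    f x = refl
Σ<-distribʳ-* (suc n) f x =
  trans (cong (_+ f n * x) (Σ<-distribʳ-* n f x)) (sym (*-distribʳ-+ x (Σ< n f) (f n)))

Σ<-unfoldˡ : ∀ n (f : ℕ → ℕ) → Σ< (suc n) f ≡ f 0 + Σ< n (λ i → f (suc i))
Σ<-unfoldˡ zero    f = sym (+-identityʳ (f 0))
Σ<-unfoldˡ (suc n) f =
  trans (cong (_+ f (suc n)) (Σ<-unfoldˡ n f)) (+-assoc (f 0) _ (f (suc n)))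

Σ<-comm : ∀ n m (h : ℕ → ℕ → ℕ) →
          Σ< n (λ i → Σ< m (h i)) ≡ Σ< m (λ t → Σ< n (λ i → h i t))
Σ<-comm zero    m h = sym (trans (Σ<-const m 0) (*-zeroʳ m))
Σ<-comm (suc n) m h = begin
  Σ< n (λ i → Σ< m (h i)) + Σ< m (h n)          ≡⟨ cong (_+ Σ< m (h n)) (Σ<-comm n m h) ⟩
  Σ< m (λ t → Σ< n (λ i → h i t)) + Σ< m (h n)  ≡⟨ Σ<-distrib-+ m _ (h n) ⟨
  Σ< m (λ t → Σ< n (λ i → h i t) + h n t)       ∎

Σ<-reverse : ∀ n (f : ℕ → ℕ) → Σ< n f ≡ Σ< n (λ i → f (n ∸ suc i))
Σ<-reverse zero    f = refl
Σ<-reverse (suc n) f = begin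
  Σ< n f + f n                        ≡⟨ cong (_+ f n) (Σ<-reverse n f) ⟩
  Σ< n (λ i → f (n ∸ suc i)) + f n    ≡⟨ +-comm _ (f n) ⟩
  f n + Σ< n (λ i → f (n ∸ suc i))    ≡⟨ Σ<-unfoldˡ n (λ i → f (n ∸ i)) ⟨
  Σ< (suc n) (λ i → f (n ∸ i))        ∎

m∸n≡suc[m∸suc[n]] : ∀ {m n} → n < m → m ∸ n ≡ suc (m ∸ suc n)
m∸n≡suc[m∸suc[n]] n<m = +-∸-assoc 1 n<m

Σ<-convolution-comm : ∀ n (f g : ℕ → ℕ) →
  Σ< (suc n) (λ i → f i * g (n ∸ i)) ≡ Σ< (suc n) (λ i → g i * f (n ∸ i))
Σ<-convolution-comm n f g =
  trans (Σ<-reverse (suc n) _) (Σ<-cong (suc n) λ i i≤n →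
    trans (cong (λ t → f (n ∸ i) * g t) (m∸[m∸n]≡n (≤-pred i≤n))) (*-comm (f (n ∸ i)) (g i)))

-- The generating tree

child : ℕ → ℕ → ℕ → ℕ
child c j zero    = suc j
child c j (suc p) = c ⊓ suc (suc p)

descendants : ℕ → ℕ → ℕ → ℕ
descendants c zero    j = 1
descendants c (suc n) j = Σ< j (λ p → descendants c n (child c j p))

levelSize : ℕ → ℕ → ℕ
levelSize c n = descendants c n 1

descendants-unfold-raisedCap : ∀ e m j →
  descendants (2 + e) (suc m) (suc j) ≡
  descendants (2 + e) m 2 + Σ< j (λ p → descendants (2 + e) m (suc (child (suc e) j p)))
descendants-unfold-raisedCap e m zero    = sym (+-identityʳ _)
descendants-unfold-raisedCap e m (suc i) = begin
  Σ< (2 + i) f                         ≡⟨ Σ<-unfoldˡ (suc i) f ⟩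
  f 0 + Σ< (suc i) (λ p → f (suc p))   ≡⟨ cong (f 0 +_) (Σ<-unfoldˡ i (λ p → f (suc p))) ⟩
  f 0 + (f 1 + Σ< i (λ p → f (2 + p))) ≡⟨ +-exchange (f 0) (f 1) _ ⟩
  f 1 + (f 0 + Σ< i (λ p → f (2 + p))) ≡⟨ cong (f 1 +_) (Σ<-unfoldˡ i g) ⟨
  f 1 + Σ< (suc i) g
    ≡⟨ cong (λ x → descendants (2 + e) m (2 + x) + Σ< (suc i) g) (⊓-zeroʳ e) ⟩
  descendants (2 + e) m 2 + Σ< (suc i) g ∎
  where
  g : ℕ → ℕ
  g p = descendants (2 + e) m (suc (child (suc e) (suc i) p))
  f : ℕ → ℕ
  f p = descendants (2 + e) m (child (2 + e) (2 + i) p)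
  +-exchange : ∀ a b c → a + (b + c) ≡ b + (a + c)
  +-exchange = solve-∀

-- Raising the cap to 2 + e, every node t generations below label j gains an
-- extra child labelled 2, whose subtrees give the t-th summand.
descendants-raiseCap : ∀ e n j →
  descendants (2 + e) n (suc j) ≡
  descendants (suc e) n j + Σ< n (λ t → descendants (suc e) t j * descendants (2 + e) (n ∸ suc t) 2)
descendants-raiseCap e zero    j = refl
descendants-raiseCap e (suc m) j = begin
  descendants (2 + e) (suc m) (suc j)
    ≡⟨ descendants-unfold-raisedCap e m j ⟩
  D₊ m 2 + Σ< j (λ p → D₊ m (suc (kid p)))
    ≡⟨ cong (D₊ m 2 +_) (Σ<-cong j λ p _ → descendants-raiseCap e m (kid p)) ⟩
  D₊ m 2 + Σ< j (λ p → D m (kid p) + Σ< m (λ t → D t (kid p) * D₊ (m ∸ suc t) 2))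
    ≡⟨ cong (D₊ m 2 +_) (Σ<-distrib-+ j _ _) ⟩
  D₊ m 2 + (D (suc m) j + Σ< j (λ p → Σ< m (λ t → D t (kid p) * D₊ (m ∸ suc t) 2)))
    ≡⟨ cong (λ s → D₊ m 2 + (D (suc m) j + s)) (Σ<-comm j m _) ⟩
  D₊ m 2 + (D (suc m) j + Σ< m (λ t → Σ< j (λ p → D t (kid p) * D₊ (m ∸ suc t) 2)))
    ≡⟨ cong (λ s → D₊ m 2 + (D (suc m) j + s)) (Σ<-cong m λ t _ → Σ<-distribʳ-* j _ _) ⟩
  D₊ m 2 + (D (suc m) j + Σ< m (λ t → D (suc t) j * D₊ (m ∸ suc t) 2))
    ≡⟨ regroup (D₊ m 2) (D (suc m) j) _ ⟩
  D (suc m) j + (1 * D₊ m 2 + Σ< m (λ t → D (suc t) j * D₊ (m ∸ suc t) 2))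
    ≡⟨ cong (D (suc m) j +_) (Σ<-unfoldˡ m (λ t → D t j * D₊ (suc m ∸ suc t) 2)) ⟨
  D (suc m) j + Σ< (suc m) (λ t → D t j * D₊ (suc m ∸ suc t) 2) ∎
  where
  D = descendants (suc e)
  D₊ = descendants (2 + e)
  kid = child (suc e) j
  regroup : ∀ a b s → a + (b + s) ≡ b + (1 * a + s)
  regroup = solve-∀

levelSize-convolution : ∀ e n →
  levelSize (2 + e) (suc n) ≡ Σ< (suc n) (λ t → levelSize (suc e) t * levelSize (2 + e) (n ∸ t))
levelSize-convolution e n = begin
  descendants (2 + e) n 2
    ≡⟨ descendants-raiseCap e n 1 ⟩
  G n + Σ< n (λ t → G t * descendants (2 + e) (n ∸ suc t) 2)
    ≡⟨ cong (G n +_) (Σ<-cong n λ t t<n → cong (λ s → G t * G₊ s) (m∸n≡suc[m∸suc[n]] t<n) ) ⟨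
  G n + Σ< n (λ t → G t * G₊ (n ∸ t))
    ≡⟨ +-comm (G n) _ ⟩
  Σ< n (λ t → G t * G₊ (n ∸ t)) + G n
    ≡⟨ cong (Σ< n (λ t → G t * G₊ (n ∸ t)) +_) (trans (sym (*-identityʳ (G n))) (cong (λ s → G n * G₊ s) (sym (n∸n≡0 n)))) ⟩
  Σ< (suc n) (λ t → G t * G₊ (n ∸ t)) ∎
  where
  G = levelSize (suc e)
  G₊ = levelSize (2 + e)

mutual
  base₂ : ℕ → ℕ
  base₂ zero    = 1
  base₂ (suc n) = base₂ n + base₂ n + slope₂ n

  slope₂ : ℕ → ℕ
  slope₂ zero    = 0
  slope₂ (suc n) = base₂ n + slope₂ n

descendants₂-affine : ∀ n i → descendants 2 n (2 + i) ≡ base₂ n + i * slope₂ n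
descendants₂-affine zero    i = cong suc (sym (*-zeroʳ i))
descendants₂-affine (suc n) i = begin
  Σ< (2 + i) (λ p → descendants 2 n (child 2 (2 + i) p))
    ≡⟨ Σ<-unfoldˡ (1 + i) _ ⟩
  descendants 2 n (3 + i) + Σ< (1 + i) (λ _ → descendants 2 n 2)
    ≡⟨ cong₂ _+_ (descendants₂-affine n (suc i)) (Σ<-const (1 + i) _) ⟩
  (A + suc i * B) + suc i * descendants 2 n 2
    ≡⟨ cong (λ x → (A + suc i * B) + suc i * x) (trans (descendants₂-affine n 0) (+-identityʳ A)) ⟩
  (A + suc i * B) + suc i * A
    ≡⟨ collect A B i ⟩
  (A + A + B) + i * (A + B) ∎
  where
  A = base₂ n
  B = slope₂ n
  collect : ∀ a b i → (a + suc i * b) + suc i * a ≡ (a + a + b) + i * (a + b)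
  collect = solve-∀

levelSize₂-suc : ∀ n → levelSize 2 (suc n) ≡ base₂ n
levelSize₂-suc n = trans (descendants₂-affine n 0) (+-identityʳ (base₂ n))

levelSize₂-recurrence : ∀ m → levelSize 2 (2 + m) + levelSize 2 m ≡ 3 * levelSize 2 (1 + m)
levelSize₂-recurrence zero    = refl
levelSize₂-recurrence (suc m) = begin
  levelSize 2 (3 + m) + levelSize 2 (1 + m) ≡⟨ cong₂ _+_ (levelSize₂-suc (2 + m)) (levelSize₂-suc m) ⟩
  base₂ (2 + m) + base₂ m                   ≡⟨ recurrence (base₂ m) (slope₂ m) ⟩
  3 * base₂ (1 + m)                         ≡⟨ cong (3 *_) (levelSize₂-suc (1 + m)) ⟨
  3 * levelSize 2 (2 + m)                   ∎
  where
  recurrence : ∀ a b → ((a + a + b) + (a + a + b) + (a + b)) + a ≡ 3 * (a + a + b)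
  recurrence = solve-∀

-- Ballot numbers and the Catalan limit

child∞ : ℕ → ℕ → ℕ
child∞ j zero    = suc j
child∞ j (suc p) = suc (suc p)

descendants∞ : ℕ → ℕ → ℕ
descendants∞ zero    j = 1
descendants∞ (suc n) j = Σ< j (λ p → descendants∞ n (child∞ j p))

descendants-uncapped : ∀ n j c → j + n ≤ c → descendants c n j ≡ descendants∞ n j
descendants-uncapped zero    j c _ = refl
descendants-uncapped (suc n) j c j+n<c = Σ<-cong j children
  where
  children : ∀ p → p < j → descendants c n (child c j p) ≡ descendants∞ n (child∞ j p)
  children zero    _   = descendants-uncapped n (suc j) c (subst (_≤ c) (+-suc j n) j+n<c)
  children (suc p) p<j = trans (cong (descendants c n) (m≥n⇒m⊓n≡n (≤-trans p<j (≤-trans (m≤m+n j (suc n)) j+n<c))))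
    (descendants-uncapped n (2 + p) c (≤-trans (+-monoˡ-≤ n p<j) (≤-trans (+-monoʳ-≤ j (n≤1+n n)) j+n<c)))

descendants∞-suc-label : ∀ d i →
  descendants∞ (suc d) (2 + i) ≡ descendants∞ (suc d) (1 + i) + descendants∞ d (3 + i)
descendants∞-suc-label d i = begin
  Σ< (2 + i) (λ p → D (child∞ (2 + i) p))             ≡⟨ Σ<-unfoldˡ (1 + i) _ ⟩
  D (3 + i) + (Σ< i (λ p → D (2 + p)) + D (2 + i))    ≡⟨ +-comm (D (3 + i)) _ ⟩
  Σ< i (λ p → D (2 + p)) + D (2 + i) + D (3 + i)      ≡⟨ cong (_+ D (3 + i)) (+-comm (Σ< i (λ p → D (2 + p))) _) ⟩
  D (2 + i) + Σ< i (λ p → D (2 + p)) + D (3 + i)      ≡⟨ cong (_+ D (3 + i)) (Σ<-unfoldˡ i _) ⟨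
  Σ< (1 + i) (λ p → D (child∞ (1 + i) p)) + D (3 + i) ∎
  where
  D = descendants∞ d

-- m C (d ∸ 1), except that it vanishes at d = 0.
_C⁻_ : ℕ → ℕ → ℕ
m C⁻ zero    = 0
m C⁻ (suc d) = m C d

pascal : ∀ m d → suc m C d ≡ m C⁻ d + m C d
pascal m zero    = refl
pascal m (suc d) = sym (nCk+nC[k+1]≡[n+1]C[k+1] m d)

central-symmetry : ∀ e → (e + e + 1) C e ≡ (e + e + 1) C suc e
central-symmetry e = trans (nCk≡nC[n∸k] (≤-trans (m≤m+n e e) (m≤m+n (e + e) 1)))
  (cong ((e + e + 1) C_) (trans (cong (_∸ e) (shape e)) (m+n∸m≡n e (suc e))))
  where
  shape : ∀ e → e + e + 1 ≡ e + suc e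
  shape = solve-∀

-- Ballot numbers C(2d+i, d) − C(2d+i, d−1), stated without subtraction; M is
-- generalised so that the recursive calls need no rewriting.
descendants∞-ballot : ∀ d i M → M ≡ d + d + i → descendants∞ d (suc i) + M C⁻ d ≡ M C d
descendants∞-ballot zero    i       M _    = refl
descendants∞-ballot (suc e) zero    M M≡ = begin
  descendants∞ e 2 + M C e                ≡⟨ cong (λ x → descendants∞ e 2 + x C e) (trans M≡ (shape e)) ⟩
  descendants∞ e 2 + suc N C e            ≡⟨ cong (descendants∞ e 2 +_) (pascal N e) ⟩
  descendants∞ e 2 + (N C⁻ e + N C e)     ≡⟨ +-assoc (descendants∞ e 2) _ _ ⟨
  descendants∞ e 2 + N C⁻ e + N C e       ≡⟨ cong (_+ N C e) (descendants∞-ballot e 1 N refl) ⟩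
  N C e + N C e                           ≡⟨ cong (N C e +_) (central-symmetry e) ⟩
  N C e + N C suc e                       ≡⟨ nCk+nC[k+1]≡[n+1]C[k+1] N e ⟩
  suc N C suc e                           ≡⟨ cong (λ x → x C suc e) (trans M≡ (shape e)) ⟨
  M C suc e                               ∎
  where
  N = e + e + 1
  shape : ∀ e → suc e + suc e + 0 ≡ suc (e + e + 1)
  shape = solve-∀
descendants∞-ballot (suc e) (suc i) M M≡ = begin
  descendants∞ (suc e) (2 + i) + M C e
    ≡⟨ cong₂ (λ x y → x + y C e) (descendants∞-suc-label e i) (trans M≡ (shape₁ e i)) ⟩
  (descendants∞ (suc e) (1 + i) + descendants∞ e (3 + i)) + suc N C e
    ≡⟨ cong (descendants∞ (suc e) (1 + i) + descendants∞ e (3 + i) +_) (pascal N e) ⟩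
  (descendants∞ (suc e) (1 + i) + descendants∞ e (3 + i)) + (N C⁻ e + N C e)
    ≡⟨ regroup (descendants∞ (suc e) (1 + i)) _ _ _ ⟩
  (descendants∞ (suc e) (1 + i) + N C e) + (descendants∞ e (3 + i) + N C⁻ e)
    ≡⟨ cong₂ _+_ (descendants∞-ballot (suc e) i N refl) (descendants∞-ballot e (2 + i) N (shape₂ e i)) ⟩
  N C suc e + N C e
    ≡⟨ +-comm (N C suc e) _ ⟩
  N C e + N C suc e
    ≡⟨ nCk+nC[k+1]≡[n+1]C[k+1] N e ⟩
  suc N C suc e
    ≡⟨ cong (λ x → x C suc e) (trans M≡ (shape₁ e i)) ⟨
  M C suc e ∎
  where
  N = suc e + suc e + i
  shape₁ : ∀ e i → suc e + suc e + suc i ≡ suc (suc e + suc e + i)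
  shape₁ = solve-∀
  shape₂ : ∀ e i → suc e + suc e + i ≡ e + e + (2 + i)
  shape₂ = solve-∀
  regroup : ∀ a b c d → (a + b) + (c + d) ≡ (a + d) + (b + c)
  regroup = solve-∀

binomial-absorption : ∀ n k → suc k * (suc n C suc k) ≡ suc n * (n C k)
binomial-absorption zero    zero    = refl
binomial-absorption zero    (suc k) = *-zeroʳ (2 + k)
binomial-absorption (suc n) zero    = trans (*-identityˡ _) (trans (nC1≡n (2 + n)) (sym (*-identityʳ (2 + n))))
binomial-absorption (suc n) (suc k) = begin
  (2 + k) * (suc n′ C suc k′)
    ≡⟨ cong ((2 + k) *_) (nCk+nC[k+1]≡[n+1]C[k+1] n′ k′) ⟨
  (2 + k) * (n′ C k′ + n′ C suc k′)
    ≡⟨ *-distribˡ-+ (2 + k) (n′ C k′) _ ⟩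
  (2 + k) * (n′ C k′) + (2 + k) * (n′ C suc k′)
    ≡⟨ cong₂ (λ x y → n′ C k′ + x + y) (binomial-absorption n k) (binomial-absorption n k′) ⟩
  n′ C k′ + n′ * (n C k) + n′ * (n C k′)
    ≡⟨ regroup (n′ C k′) n′ (n C k) _ ⟩
  n′ C k′ + n′ * (n C k + n C k′)
    ≡⟨ cong (λ x → n′ C k′ + n′ * x) (nCk+nC[k+1]≡[n+1]C[k+1] n k) ⟩
  (2 + n) * (n′ C k′) ∎
  where
  n′ = suc n
  k′ = suc k
  regroup : ∀ x a u v → (x + a * u) + a * v ≡ x + a * (u + v)
  regroup = solve-∀

[1+n]*[n+n]C⁻n≡n*[n+n]Cn : ∀ n → suc n * ((n + n) C⁻ n) ≡ n * ((n + n) C n)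
[1+n]*[n+n]C⁻n≡n*[n+n]Cn zero    = refl
[1+n]*[n+n]C⁻n≡n*[n+n]Cn (suc e) = begin
  (2 + e) * (N C e)          ≡⟨ cong ((2 + e) *_) upper ⟩
  (2 + e) * (suc N₁ C (2 + e)) ≡⟨ binomial-absorption N₁ (suc e) ⟩
  suc N₁ * (N₁ C suc e)      ≡⟨ cong (suc N₁ *_) lower ⟩
  suc N₁ * (N₁ C e)          ≡⟨ binomial-absorption N₁ e ⟨
  suc e * (suc N₁ C suc e)   ∎
  where
  N = suc e + suc e
  N₁ = e + suc e
  upper : N C e ≡ suc N₁ C (2 + e)
  upper = trans (nCk≡nC[n∸k] (≤-trans (n≤1+n e) (m≤m+n (suc e) (suc e))))
    (cong (N C_) (trans (cong (_∸ e) (shape e)) (m+n∸n≡m (2 + e) e)))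
    where
    shape : ∀ e → suc e + suc e ≡ 2 + e + e
    shape = solve-∀
  lower : N₁ C suc e ≡ N₁ C e
  lower = trans (nCk≡nC[n∸k] (m≤n+m (suc e) e)) (cong (N₁ C_) (m+n∸n≡m e (suc e)))

descendants∞-catalan : ∀ n → descendants∞ n 1 ≡ catalan n
descendants∞-catalan n = sym (begin
  ((2 * n) C n) / suc n              ≡⟨ cong (λ x → (x C n) / suc n) (double n) ⟩
  ((n + n) C n) / suc n              ≡⟨ cong (_/ suc n) numerator ⟨
  (suc n * descendants∞ n 1) / suc n ≡⟨ cong (_/ suc n) (*-comm (suc n) (descendants∞ n 1)) ⟩
  (descendants∞ n 1 * suc n) / suc n ≡⟨ m*n/n≡m (descendants∞ n 1) (suc n) ⟩
  descendants∞ n 1                   ∎)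
  where
  double : ∀ n → 2 * n ≡ n + n
  double = solve-∀
  ballot = descendants∞-ballot n 0 (n + n) (sym (+-identityʳ (n + n)))
  numerator : suc n * descendants∞ n 1 ≡ (n + n) C n
  numerator = +-cancelʳ-≡ (n * ((n + n) C n)) (suc n * descendants∞ n 1) ((n + n) C n) (begin
    suc n * descendants∞ n 1 + n * ((n + n) C n)       ≡⟨ cong (suc n * descendants∞ n 1 +_) ([1+n]*[n+n]C⁻n≡n*[n+n]Cn n) ⟨
    suc n * descendants∞ n 1 + suc n * ((n + n) C⁻ n)  ≡⟨ *-distribˡ-+ (suc n) (descendants∞ n 1) ((n + n) C⁻ n) ⟨
    suc n * (descendants∞ n 1 + (n + n) C⁻ n)          ≡⟨ cong (suc n *_) ballot ⟩
    (n + n) C n + n * ((n + n) C n)                    ∎)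

levelSize-catalan : ∀ c n → n < c → levelSize c n ≡ catalan n
levelSize-catalan c n n<c = trans (descendants-uncapped n 1 c n<c) (descendants∞-catalan n)

catalan-convolution : ∀ m → catalan (suc m) ≡ Σ< (suc m) (λ i → catalan i * catalan (m ∸ i))
catalan-convolution m = begin
  catalan (suc m)                                          ≡⟨ levelSize-catalan (2 + m) (suc m) ≤-refl ⟨
  levelSize (2 + m) (suc m)                                ≡⟨ levelSize-convolution m m ⟩
  Σ< (suc m) (λ i → levelSize (suc m) i * levelSize (2 + m) (m ∸ i)) ≡⟨ Σ<-cong (suc m) stable ⟩
  Σ< (suc m) (λ i → catalan i * catalan (m ∸ i))          ∎
  where
  stable : ∀ i → i < suc m → levelSize (suc m) i * levelSize (2 + m) (m ∸ i) ≡ catalan i * catalan (m ∸ i)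
  stable i i<1+m = cong₂ _*_ (levelSize-catalan (suc m) i i<1+m)
                             (levelSize-catalan (2 + m) (m ∸ i) (s≤s (≤-trans (m∸n≤m m i) (n≤1+n m))))

private variable
  A B C : Set

remove : ∀ {x : A} (ys : List A) → x ∈ ys → List A
remove (y ∷ ys) (here _)  = ys
remove (y ∷ ys) (there i) = y ∷ remove ys i

length-remove : ∀ {x : A} (ys : List A) (i : x ∈ ys) → suc (length (remove ys i)) ≡ length ys
length-remove (y ∷ ys) (here _)  = refl
length-remove (y ∷ ys) (there i) = cong suc (length-remove ys i)

∈-remove : ∀ {x y : A} (ys : List A) (i : x ∈ ys) → y ∈ ys → y ≢ x → y ∈ remove ys i
∈-remove (_ ∷ ys) (here refl) (here refl) y≢x = ⊥-elim (y≢x refl)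
∈-remove (_ ∷ ys) (here refl) (there k)   _   = k
∈-remove (_ ∷ ys) (there i)   (here y≡z)  _   = here y≡z
∈-remove (_ ∷ ys) (there i)   (there k)   y≢x = there (∈-remove ys i k y≢x)

unique-⊆⇒length≤ : ∀ (xs ys : List A) → Unique xs → (∀ x → x ∈ xs → x ∈ ys) → length xs ≤ length ys
unique-⊆⇒length≤ []       ys _               _    = z≤n
unique-⊆⇒length≤ (x ∷ xs) ys (x∉xs ∷ uniq) xs⊆ys =
  subst (suc (length xs) ≤_) (length-remove ys x∈ys) (s≤s (unique-⊆⇒length≤ xs (remove ys x∈ys) uniq xs⊆ys─x))
  where
  x∈ys = xs⊆ys x (here refl)
  xs⊆ys─x : ∀ y → y ∈ xs → y ∈ remove ys x∈ys
  xs⊆ys─x y y∈xs = ∈-remove ys x∈ys (xs⊆ys y (there y∈xs)) (λ y≡x → All.lookup x∉xs y∈xs (sym y≡x))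

HasSize-unique : ∀ {P : A → Set} {m m′} → HasSize P m → HasSize P m′ → m ≡ m′
HasSize-unique (xs , uniq-xs , refl , xs↔P) (ys , uniq-ys , refl , ys↔P) = ≤-antisym
  (unique-⊆⇒length≤ xs ys uniq-xs (λ x x∈xs → Equivalence.from (ys↔P x) (Equivalence.to (xs↔P x) x∈xs)))
  (unique-⊆⇒length≤ ys xs uniq-ys (λ x x∈ys → Equivalence.from (xs↔P x) (Equivalence.to (ys↔P x) x∈ys)))

unique-map : ∀ (f : A → B) (xs : List A) → Unique xs → (∀ x y → x ∈ xs → y ∈ xs → f x ≡ f y → x ≡ y) → Unique (map f xs)
unique-map f []       _            _         = []
unique-map f (x ∷ xs) (x∉xs ∷ uniq) injective =
  All.map⁺ (All.tabulate λ y∈xs fx≡fy → All.lookup x∉xs y∈xs (injective _ _ (here refl) (there y∈xs) fx≡fy)) ∷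
  unique-map f xs uniq (λ a b a∈ b∈ → injective a b (there a∈) (there b∈))

unique-concatMap : ∀ (f : A → List B) (g : A → C) (xs : List A) → Unique (map g xs) →
  (∀ x → x ∈ xs → Unique (f x)) →
  (∀ x y b → x ∈ xs → y ∈ xs → b ∈ f x → b ∈ f y → g x ≡ g y) →
  Unique (concatMap f xs)
unique-concatMap f g []       _                   _      _        = []
unique-concatMap f g (x ∷ xs) (gx∉gxs ∷ uniq-gxs) uniq-f disjoint =
  Unique.++⁺ (uniq-f x (here refl))
    (unique-concatMap f g xs uniq-gxs (λ y y∈xs → uniq-f y (there y∈xs)) (λ y z b y∈ z∈ → disjoint y z b (there y∈) (there z∈)))
    (λ (b∈fx , b∈rest) → apart b∈fx b∈rest)
  where
  apart : ∀ {b} → b ∈ f x → b ∈ concatMap f xs → ⊥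
  apart b∈fx b∈rest with find (∈-concatMap⁻ f b∈rest)
  ... | y , y∈xs , b∈fy = All.lookup gx∉gxs (∈-map⁺ g y∈xs) (disjoint x y _ (here refl) (there y∈xs) b∈fx b∈fy)

length≡sum-map-1 : ∀ {A : Set} (xs : List A) → length xs ≡ sum (map (λ _ → 1) xs)
length≡sum-map-1 []       = refl
length≡sum-map-1 (x ∷ xs) = cong suc (length≡sum-map-1 xs)

sum-map-concatMap : ∀ (g : B → ℕ) (f : A → List B) xs → sum (map g (concatMap f xs)) ≡ sum (map (sum ∘ map g ∘ f) xs)
sum-map-concatMap g f []       = refl
sum-map-concatMap g f (x ∷ xs) = begin
  sum (map g (f x ++ concatMap f xs))          ≡⟨ cong sum (map-++ g (f x) _) ⟩
  sum (map g (f x) ++ map g (concatMap f xs))  ≡⟨ sum-++ (map g (f x)) _ ⟩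
  sum (map g (f x)) + sum (map g (concatMap f xs))       ≡⟨ cong (sum (map g (f x)) +_) (sum-map-concatMap g f xs) ⟩
  sum (map g (f x)) + sum (map (sum ∘ map g ∘ f) xs)     ∎

sum-map-applyUpTo : ∀ (g : A → ℕ) (f : ℕ → A) j → sum (map g (applyUpTo f j)) ≡ Σ< j (g ∘ f)
sum-map-applyUpTo g f zero    = refl
sum-map-applyUpTo g f (suc j) =
  trans (cong (g (f 0) +_) (sum-map-applyUpTo g (f ∘ suc) j)) (sym (Σ<-unfoldˡ j (g ∘ f)))

-- Inserting the maximum

Perm : ℕ → Set
Perm n = Vec (Fin n) n

val : ∀ {n m} → Vec (Fin n) m → Fin m → ℕ
val π i = toℕ (lookup π i)

val< : ∀ {n m} (π : Vec (Fin n) m) i → val π i < n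
val< π i = toℕ<n (lookup π i)

insertMax : ∀ {n} → Perm n → Fin (suc n) → Perm (suc n)
insertMax {n} π p = insertAt (Vec.map inject₁ π) p (fromℕ n)

lookup-insertMax-punchIn : ∀ {n} (π : Perm n) p i → lookup (insertMax π p) (punchIn p i) ≡ inject₁ (lookup π i)
lookup-insertMax-punchIn {n} π p i =
  trans (Vecₚ.insertAt-punchIn (Vec.map inject₁ π) p (fromℕ n) i) (Vecₚ.lookup-map i inject₁ π)

val-insertMax-at : ∀ {n} (π : Perm n) p → val (insertMax π p) p ≡ n
val-insertMax-at {n} π p = trans (cong toℕ (Vecₚ.insertAt-lookup (Vec.map inject₁ π) p (fromℕ n))) (Fin.toℕ-fromℕ n)

val-insertMax-punchIn : ∀ {n} (π : Perm n) p i → val (insertMax π p) (punchIn p i) ≡ val π i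
val-insertMax-punchIn π p i = trans (cong toℕ (lookup-insertMax-punchIn π p i)) (Fin.toℕ-inject₁ (lookup π i))

lookup-insertMax-at≢punchIn : ∀ {n} (π : Perm n) p j → lookup (insertMax π p) p ≢ lookup (insertMax π p) (punchIn p j)
lookup-insertMax-at≢punchIn π p j eq =
  <-irrefl (sym (trans (sym (val-insertMax-at π p)) (trans (cong toℕ eq) (val-insertMax-punchIn π p j)))) (val< π j)

punchIn-or-pivot : ∀ {n} (p x : Fin (suc n)) → x ≡ p ⊎ ∃ λ i → punchIn p i ≡ x
punchIn-or-pivot p x with p Fin.≟ x
... | yes p≡x = inj₁ (sym p≡x)
... | no  p≢x = inj₂ (punchOut p≢x , Fin.punchIn-punchOut p≢x)

toℕ-punchIn-< : ∀ {n} (p : Fin (suc n)) (i : Fin n) → toℕ i < toℕ p → toℕ (punchIn p i) ≡ toℕ i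
toℕ-punchIn-< (Fin.suc p) 0F          _         = refl
toℕ-punchIn-< (Fin.suc p) (Fin.suc i) (s≤s i<p) = cong suc (toℕ-punchIn-< p i i<p)

toℕ-punchIn-≥ : ∀ {n} (p : Fin (suc n)) (i : Fin n) → toℕ p ≤ toℕ i → toℕ (punchIn p i) ≡ suc (toℕ i)
toℕ-punchIn-≥ 0F          i           _         = refl
toℕ-punchIn-≥ (Fin.suc p) (Fin.suc i) (s≤s p≤i) = cong suc (toℕ-punchIn-≥ p i p≤i)

punchIn-<⁻ : ∀ {n} (p : Fin (suc n)) (i : Fin n) → toℕ (punchIn p i) < toℕ p → toℕ i < toℕ p
punchIn-<⁻ (Fin.suc p) 0F          _         = z<s
punchIn-<⁻ (Fin.suc p) (Fin.suc i) (s≤s i<p) = s≤s (punchIn-<⁻ p i i<p)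

punchIn->⁻ : ∀ {n} (p : Fin (suc n)) (i : Fin n) → toℕ p < toℕ (punchIn p i) → toℕ p ≤ toℕ i
punchIn->⁻ 0F          i           _         = z≤n
punchIn->⁻ (Fin.suc p) (Fin.suc i) (s≤s p<i) = s≤s (punchIn->⁻ p i p<i)

punchIn-mono-< : ∀ {n} (p : Fin (suc n)) (i j : Fin n) → i Fin.< j → punchIn p i Fin.< punchIn p j
punchIn-mono-< 0F          i           j           i<j       = s≤s i<j
punchIn-mono-< (Fin.suc p) 0F          (Fin.suc j) _         = z<s
punchIn-mono-< (Fin.suc p) (Fin.suc i) (Fin.suc j) (s≤s i<j) = s≤s (punchIn-mono-< p i j i<j)

punchIn-cancel-< : ∀ {n} (p : Fin (suc n)) (i j : Fin n) → punchIn p i Fin.< punchIn p j → i Fin.< j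
punchIn-cancel-< 0F          i           j           (s≤s i<j) = i<j
punchIn-cancel-< (Fin.suc p) 0F          (Fin.suc j) _         = z<s
punchIn-cancel-< (Fin.suc p) (Fin.suc i) (Fin.suc j) (s≤s i<j) = s≤s (punchIn-cancel-< p i j i<j)

strictlyIncreasing⇒≤ : ∀ {m N} (q : Fin m → Fin N) → (∀ a b → a Fin.< b → q a Fin.< q b) → ∀ a → toℕ a ≤ toℕ (q a)
strictlyIncreasing⇒≤ {m} q increasing a = bound (toℕ a) a refl
  where
  bound : ∀ t (a : Fin m) → toℕ a ≡ t → t ≤ toℕ (q a)
  bound zero    a           _   = z≤n
  bound (suc t) (Fin.suc a) a≡t = ≤-<-trans (bound t (inject₁ a) (trans (Fin.toℕ-inject₁ a) (suc-injective a≡t)))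
    (increasing (inject₁ a) (Fin.suc a) (subst (_< suc (toℕ a)) (sym (Fin.toℕ-inject₁ a)) (n<1+n _)))

insertMax-IsPerm : ∀ {n} (π : Perm n) p → IsPerm π → IsPerm (insertMax π p)
insertMax-IsPerm π p πinj x y πx≡πy with punchIn-or-pivot p x | punchIn-or-pivot p y
... | inj₁ refl       | inj₁ refl       = refl
... | inj₁ refl       | inj₂ (j , refl) = ⊥-elim (lookup-insertMax-at≢punchIn π p j πx≡πy)
... | inj₂ (i , refl) | inj₁ refl       = ⊥-elim (lookup-insertMax-at≢punchIn π p i (sym πx≡πy))
... | inj₂ (i , refl) | inj₂ (j , refl) = cong (punchIn p) (πinj i j (Fin.inject₁-injective
  (trans (sym (lookup-insertMax-punchIn π p i)) (trans πx≡πy (lookup-insertMax-punchIn π p j)))))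

insertMax-injectiveˡ : ∀ {n} (π π′ : Perm n) p p′ → insertMax π p ≡ insertMax π′ p′ → p ≡ p′
insertMax-injectiveˡ π π′ p p′ eq with punchIn-or-pivot p′ p
... | inj₁ p≡p′       = p≡p′
... | inj₂ (y , refl) = ⊥-elim (<-irrefl (sym n≡π′y) (val< π′ y))
  where
  n≡π′y = trans (sym (val-insertMax-at π p)) (trans (cong (λ τ → val τ p) eq) (val-insertMax-punchIn π′ p′ y))

insertMax-injectiveʳ : ∀ {n} (π π′ : Perm n) p → insertMax π p ≡ insertMax π′ p → π ≡ π′
insertMax-injectiveʳ π π′ p eq =
  trans (sym (Vecₚ.tabulate∘lookup π)) (trans (Vecₚ.tabulate-cong pointwise) (Vecₚ.tabulate∘lookup π′))
  where
  pointwise : ∀ i → lookup π i ≡ lookup π′ i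
  pointwise i = Fin.inject₁-injective (trans (sym (lookup-insertMax-punchIn π p i))
    (trans (cong (λ τ → lookup τ (punchIn p i)) eq) (lookup-insertMax-punchIn π′ p i)))

maxPosition : ∀ {n} (π : Perm (suc n)) → IsPerm π → ∃ λ p → lookup π p ≡ fromℕ n
maxPosition {n} π πinj with Fin.any? (λ i → lookup π i Fin.≟ fromℕ n)
... | yes found = found
... | no  none  = ⊥-elim (<-irrefl refl (Fin.injective⇒≤ lowered-injective))
  where
  n≢π : ∀ i → n ≢ toℕ (lookup π i)
  n≢π i eq = none (i , Fin.toℕ-injective (trans (sym eq) (sym (Fin.toℕ-fromℕ n))))
  lowered : Fin (suc n) → Fin n
  lowered i = Fin.lower₁ (lookup π i) (n≢π i)
  lowered-injective : ∀ {i j} → lowered i ≡ lowered j → i ≡ j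
  lowered-injective {i} {j} eq = πinj i j
    (trans (sym (Fin.inject₁-lower₁ _ (n≢π i))) (trans (cong inject₁ eq) (Fin.inject₁-lower₁ _ (n≢π j))))

removeMax : ∀ {n} (π′ : Perm (suc n)) → IsPerm π′ → Σ (Perm n) λ π → ∃ λ p → insertMax π p ≡ π′ × IsPerm π
removeMax {n} π′ π′inj = π , p , insertMax-π≡π′ , πinj
  where
  p = proj₁ (maxPosition π′ π′inj)
  π′p≡n = proj₂ (maxPosition π′ π′inj)
  n≢π′ : ∀ i → n ≢ toℕ (lookup π′ (punchIn p i))
  n≢π′ i eq = Fin.punchInᵢ≢i p i (π′inj _ _ (trans (Fin.toℕ-injective (trans (sym eq) (sym (Fin.toℕ-fromℕ n)))) (sym π′p≡n)))
  π : Perm n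
  π = tabulate λ i → Fin.lower₁ (lookup π′ (punchIn p i)) (n≢π′ i)
  inject-π : ∀ i → inject₁ (lookup π i) ≡ lookup π′ (punchIn p i)
  inject-π i = trans (cong inject₁ (Vecₚ.lookup∘tabulate _ i)) (Fin.inject₁-lower₁ _ (n≢π′ i))
  pointwise : ∀ x → lookup (insertMax π p) x ≡ lookup π′ x
  pointwise x with punchIn-or-pivot p x
  ... | inj₁ refl       = trans (Vecₚ.insertAt-lookup (Vec.map inject₁ π) p (fromℕ n)) (sym π′p≡n)
  ... | inj₂ (i , refl) = trans (lookup-insertMax-punchIn π p i) (inject-π i)
  insertMax-π≡π′ : insertMax π p ≡ π′
  insertMax-π≡π′ = trans (sym (Vecₚ.tabulate∘lookup (insertMax π p)))
                         (trans (Vecₚ.tabulate-cong pointwise) (Vecₚ.tabulate∘lookup π′))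
  πinj : IsPerm π
  πinj i j eq = Fin.punchIn-injective p i j (π′inj _ _ (trans (sym (inject-π i)) (trans (cong inject₁ eq) (inject-π j))))

record EntryBefore {n} (π : Perm n) (p y : Fin (suc n)) : Set where
  field
    index       : Fin n
    toℕ-index   : toℕ index ≡ toℕ y
    index<pivot : toℕ index < toℕ p
    val-index   : val π index ≡ val (insertMax π p) y

entryBefore : ∀ {n} (π : Perm n) (p y : Fin (suc n)) → toℕ y < toℕ p → EntryBefore π p y
entryBefore π p y y<p with punchIn-or-pivot p y
... | inj₁ y≡p         = ⊥-elim (<-irrefl (cong toℕ y≡p) y<p)
... | inj₂ (x , px≡y) = record
  { index       = x
  ; toℕ-index   = trans (sym (toℕ-punchIn-< p x x<p)) (cong toℕ px≡y)
  ; index<pivot = x<p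
  ; val-index   = trans (sym (val-insertMax-punchIn π p x)) (cong (val (insertMax π p)) px≡y)
  }
  where
  x<p = punchIn-<⁻ p x (subst (λ z → toℕ z < toℕ p) (sym px≡y) y<p)

record EntryAfter {n} (π : Perm n) (p y : Fin (suc n)) : Set where
  field
    index       : Fin n
    toℕ-index   : suc (toℕ index) ≡ toℕ y
    pivot≤index : toℕ p ≤ toℕ index
    val-index   : val π index ≡ val (insertMax π p) y

entryAfter : ∀ {n} (π : Perm n) (p y : Fin (suc n)) → toℕ p < toℕ y → EntryAfter π p y
entryAfter π p y p<y with punchIn-or-pivot p y
... | inj₁ y≡p         = ⊥-elim (<-irrefl (cong toℕ (sym y≡p)) p<y)
... | inj₂ (x , px≡y) = record
  { index       = x
  ; toℕ-index   = trans (sym (toℕ-punchIn-≥ p x p≤x)) (cong toℕ px≡y)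
  ; pivot≤index = p≤x
  ; val-index   = trans (sym (val-insertMax-punchIn π p x)) (cong (val (insertMax π p)) px≡y)
  }
  where
  p≤x = punchIn->⁻ p x (subst (λ z → toℕ p < toℕ z) (sym px≡y) p<y)

open EntryBefore

Occurrence : ∀ {n m} → Perm n → Vec ℕ m → (Fin m → Fin n) → Set
Occurrence {n} {m} π γ f =
  ((i j : Fin m) → i Fin.< j → f i Fin.< f j) ×
  ((i j : Fin m) → (val π (f i) < val π (f j)) ⇔ (lookup γ i < lookup γ j))

OccurrenceThrough : ∀ {n m} → Perm n → Vec ℕ m → Fin (suc n) → Set
OccurrenceThrough {n} {m} π γ p =
  Σ (Fin m → Fin (suc n)) λ f → Occurrence (insertMax π p) γ f × ∃ λ i → f i ≡ p

insertMax-Contains⁺ : ∀ {n m} (π : Perm n) (γ : Vec ℕ m) p → Contains π γ → Contains (insertMax π p) γ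
insertMax-Contains⁺ π γ p (f , mono , iso) =
  (λ i → punchIn p (f i)) , (λ i j i<j → punchIn-mono-< p (f i) (f j) (mono i j i<j)) , λ i j →
    mk⇔ (λ lt → Equivalence.to (iso i j) (subst₂ _<_ (val-insertMax-punchIn π p (f i)) (val-insertMax-punchIn π p (f j)) lt))
        (λ lt → subst₂ _<_ (sym (val-insertMax-punchIn π p (f i))) (sym (val-insertMax-punchIn π p (f j))) (Equivalence.from (iso i j) lt))

insertMax-Contains⁻ : ∀ {n m} (π : Perm n) (γ : Vec ℕ m) p →
  Contains (insertMax π p) γ → Contains π γ ⊎ OccurrenceThrough π γ p
insertMax-Contains⁻ {n} {m} π γ p (f , mono , iso) with Fin.any? (λ i → f i Fin.≟ p)
... | yes through = inj₂ (f , (mono , iso) , through)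
... | no  avoids  = inj₁ (f′ , mono′ , iso′)
  where
  p≢f : ∀ i → p ≢ f i
  p≢f i p≡fi = avoids (i , sym p≡fi)
  f′ : Fin m → Fin n
  f′ i = punchOut (p≢f i)
  punchIn-f′ : ∀ i → punchIn p (f′ i) ≡ f i
  punchIn-f′ i = Fin.punchIn-punchOut (p≢f i)
  val-f′ : ∀ i → val (insertMax π p) (f i) ≡ val π (f′ i)
  val-f′ i = trans (cong (val (insertMax π p)) (sym (punchIn-f′ i))) (val-insertMax-punchIn π p (f′ i))
  mono′ : ∀ i j → i Fin.< j → f′ i Fin.< f′ j
  mono′ i j i<j = punchIn-cancel-< p (f′ i) (f′ j)
    (subst₂ Fin._<_ (sym (punchIn-f′ i)) (sym (punchIn-f′ j)) (mono i j i<j))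
  iso′ : ∀ i j → (val π (f′ i) < val π (f′ j)) ⇔ (lookup γ i < lookup γ j)
  iso′ i j = mk⇔ (λ lt → Equivalence.to (iso i j) (subst₂ _<_ (sym (val-f′ i)) (sym (val-f′ j)) lt))
                 (λ lt → subst₂ _<_ (val-f′ i) (val-f′ j) (Equivalence.from (iso i j) lt))

occurrenceThrough-max : ∀ {n m} (π : Perm n) (γ : Vec ℕ m) p f → Occurrence (insertMax π p) γ f →
  ∀ i → f i ≡ p → ∀ i′ → i′ ≢ i → lookup γ i′ < lookup γ i
occurrenceThrough-max π γ p f (mono , iso) i fi≡p i′ i′≢i = Equivalence.to (iso i′ i) fi′<fi
  where
  fi′≢p : f i′ ≢ p
  fi′≢p fi′≡p with <-cmp (toℕ i′) (toℕ i)
  ... | tri< i′<i _ _ = <-irrefl (cong toℕ (trans fi′≡p (sym fi≡p))) (mono i′ i i′<i)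
  ... | tri≈ _ i′≡i _ = i′≢i (Fin.toℕ-injective i′≡i)
  ... | tri> _ _ i<i′ = <-irrefl (cong toℕ (trans fi≡p (sym fi′≡p))) (mono i i′ i<i′)
  fi′<fi : val (insertMax π p) (f i′) < val (insertMax π p) (f i)
  fi′<fi with punchIn-or-pivot p (f i′)
  ... | inj₁ fi′≡p       = ⊥-elim (fi′≢p fi′≡p)
  ... | inj₂ (x , px≡fi′) =
    subst₂ _<_ (trans (sym (val-insertMax-punchIn π p x)) (cong (val (insertMax π p)) px≡fi′))
               (sym (trans (cong (val (insertMax π p)) fi≡p) (val-insertMax-at π p))) (val< π x)

order-iso : ∀ {m} (w : Fin m → ℕ) (γ : Vec ℕ m) →
  (∀ a b → lookup γ a < lookup γ b → w a < w b) → (∀ a b → lookup γ a ≡ lookup γ b → a ≡ b) →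
  ∀ a b → (w a < w b) ⇔ (lookup γ a < lookup γ b)
order-iso w γ preserves injective a b = mk⇔ reflects (preserves a b)
  where
  reflects : w a < w b → lookup γ a < lookup γ b
  reflects wa<wb with <-cmp (lookup γ a) (lookup γ b)
  ... | tri< γa<γb _ _ = γa<γb
  ... | tri≈ _ γa≡γb _ = ⊥-elim (<-irrefl (cong w (injective a b γa≡γb)) wa<wb)
  ... | tri> _ _ γb<γa = ⊥-elim (<-asym wa<wb (preserves b a γb<γa))

AscentBefore : ∀ {n} → Perm n → Fin (suc n) → Set
AscentBefore {n} π p = Σ (Fin n) λ i → Σ (Fin n) λ j → (i Fin.< j) × (toℕ j < toℕ p) × (val π i < val π j)

Fin3-increasing : (g : Fin 3 → ℕ) → g 0F < g 1F → g 1F < g 2F →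
  ∀ a b → a Fin.< b → g a < g b
Fin3-increasing g g₀<g₁ g₁<g₂ 0F 1F _ = g₀<g₁
Fin3-increasing g g₀<g₁ g₁<g₂ 0F 2F _ = <-trans g₀<g₁ g₁<g₂
Fin3-increasing g g₀<g₁ g₁<g₂ 1F 2F _ = g₁<g₂
Fin3-increasing g g₀<g₁ g₁<g₂ 1F 1F (s≤s ())
Fin3-increasing g g₀<g₁ g₁<g₂ 2F 1F (s≤s ())
Fin3-increasing g g₀<g₁ g₁<g₂ 2F 2F (s≤s (s≤s ()))

lookup-p123 : ∀ a → lookup p123 a ≡ suc (toℕ a)
lookup-p123 0F = refl
lookup-p123 1F = refl
lookup-p123 2F = refl

p123-<⁻ : ∀ a b → lookup p123 a < lookup p123 b → a Fin.< b
p123-<⁻ a b lt = s<s⁻¹ (subst₂ _<_ (lookup-p123 a) (lookup-p123 b) lt)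

p123-injective : ∀ a b → lookup p123 a ≡ lookup p123 b → a ≡ b
p123-injective a b eq = Fin.toℕ-injective (suc-injective (trans (sym (lookup-p123 a)) (trans eq (lookup-p123 b))))

through123⇒ascentBefore : ∀ {n} (π : Perm n) p → OccurrenceThrough π p123 p → AscentBefore π p
through123⇒ascentBefore π p (f , occ , 0F , f₀≡p) =
  ⊥-elim (<-asym (occurrenceThrough-max π p123 p f occ 0F f₀≡p 1F (λ ())) (s≤s (s≤s z≤n)))
through123⇒ascentBefore π p (f , occ , 1F , f₁≡p) =
  ⊥-elim (<-asym (occurrenceThrough-max π p123 p f occ 1F f₁≡p 2F (λ ())) (s≤s (s≤s (s≤s z≤n))))
through123⇒ascentBefore π p (f , (mono , iso) , 2F , f₂≡p) =
  index e₀ , index e₁ ,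
  subst₂ _<_ (sym (toℕ-index e₀)) (sym (toℕ-index e₁)) (mono 0F 1F z<s) ,
  index<pivot e₁ ,
  subst₂ _<_ (sym (val-index e₀)) (sym (val-index e₁)) (Equivalence.from (iso 0F 1F) (s≤s (s≤s z≤n)))
  where
  before-p : ∀ (a : Fin 3) → toℕ a < 2 → toℕ (f a) < toℕ p
  before-p a a<2 = subst (λ z → toℕ (f a) < toℕ z) f₂≡p (mono a 2F a<2)
  e₀ = entryBefore π p (f 0F) (before-p 0F z<s)
  e₁ = entryBefore π p (f 1F) (before-p 1F (s≤s z<s))

ascentBefore⇒contains123 : ∀ {n} (π : Perm n) p → AscentBefore π p → Contains (insertMax π p) p123
ascentBefore⇒contains123 {n} π p (i , j , i<j , j<p , πi<πj) =
  f , Fin3-increasing (λ a → toℕ (f a)) f₀<f₁ f₁<f₂ ,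
  order-iso w p123 (λ a b γa<γb → Fin3-increasing w w₀<w₁ w₁<w₂ a b (p123-<⁻ a b γa<γb)) p123-injective
  where
  f : Fin 3 → Fin (suc n)
  f 0F = punchIn p i
  f 1F = punchIn p j
  f 2F = p
  w : Fin 3 → ℕ
  w a = val (insertMax π p) (f a)
  i<p = <-trans i<j j<p
  f₀<f₁ = subst₂ _<_ (sym (toℕ-punchIn-< p i i<p)) (sym (toℕ-punchIn-< p j j<p)) i<j
  f₁<f₂ = subst (_< toℕ p) (sym (toℕ-punchIn-< p j j<p)) j<p
  w₀<w₁ = subst₂ _<_ (sym (val-insertMax-punchIn π p i)) (sym (val-insertMax-punchIn π p j)) πi<πj
  w₁<w₂ = subst₂ _<_ (sym (val-insertMax-punchIn π p j)) (sym (val-insertMax-at π p)) (val< π j)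

noAscent⇒descending : ∀ {n} (π : Perm n) p → IsPerm π → ¬ AscentBefore π p →
  ∀ i i′ → i Fin.< i′ → toℕ i′ < toℕ p → val π i′ < val π i
noAscent⇒descending π p πinj noAscent i i′ i<i′ i′<p with <-cmp (val π i) (val π i′)
... | tri< πi<πi′ _ _ = ⊥-elim (noAscent (i , i′ , i<i′ , i′<p , πi<πi′))
... | tri≈ _ πi≡πi′ _ = ⊥-elim (<-irrefl (cong toℕ (πinj i i′ (Fin.toℕ-injective πi≡πi′))) i<i′)
... | tri> _ _ πi′<πi = πi′<πi

ascentThroughPivot : ∀ {n} (π : Perm n) p q → 0 < toℕ p → toℕ p < toℕ q → AscentBefore (insertMax π p) q
ascentThroughPivot π p q 0<p p<q =
  0F , p , 0<p , p<q , subst₂ _<_ (val-index first) (sym (val-insertMax-at π p)) (val< π (index first))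
  where
  first = entryBefore π p 0F 0<p

ascentBefore-insertMax₀⁺ : ∀ {n} (π : Perm n) q → AscentBefore π q → AscentBefore (insertMax π 0F) (Fin.suc q)
ascentBefore-insertMax₀⁺ π q (i , j , i<j , j<q , πi<πj) =
  Fin.suc i , Fin.suc j , s≤s i<j , s≤s j<q ,
  subst₂ _<_ (sym (val-insertMax-punchIn π 0F i)) (sym (val-insertMax-punchIn π 0F j)) πi<πj

ascentBefore-insertMax₀⁻ : ∀ {n} (π : Perm n) q → AscentBefore (insertMax π 0F) (Fin.suc q) → AscentBefore π q
ascentBefore-insertMax₀⁻ π q (0F , Fin.suc j , _ , _ , n<πj) =
  ⊥-elim (<-asym (subst₂ _<_ (val-insertMax-at π 0F) (val-insertMax-punchIn π 0F j) n<πj) (val< π j))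
ascentBefore-insertMax₀⁻ π q (Fin.suc i , Fin.suc j , s≤s i<j , s≤s j<q , πi<πj) =
  i , j , i<j , j<q , subst₂ _<_ (val-insertMax-punchIn π 0F i) (val-insertMax-punchIn π 0F j) πi<πj

-- σ_k = (k−1) ⋯ 1 (k+1) k: the descending run, the peak k + 1 and the last entry k.
data σPosition : ∀ {m} → Fin (2 + m) → Set where
  run  : ∀ {m} (a : Fin m) → σPosition (inject₁ (inject₁ a))
  peak : ∀ {m} → σPosition {m} (inject₁ (fromℕ m))
  last : ∀ {m} → σPosition {m} (fromℕ (suc m))

σposition : ∀ {m} (x : Fin (2 + m)) → σPosition x
σposition {zero}  0F           = peak
σposition {zero}  (Fin.suc 0F) = last
σposition {suc m} 0F           = run 0F
σposition {suc m} (Fin.suc x) with σposition {m} x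
... | run a = run (Fin.suc a)
... | peak  = peak
... | last  = last

toℕ-run : ∀ {m} (a : Fin m) → toℕ (inject₁ (inject₁ a)) ≡ toℕ a
toℕ-run a = trans (Fin.toℕ-inject₁ (inject₁ a)) (Fin.toℕ-inject₁ a)

toℕ-peak : ∀ m → toℕ (inject₁ (fromℕ m)) ≡ m
toℕ-peak m = trans (Fin.toℕ-inject₁ (fromℕ m)) (Fin.toℕ-fromℕ m)

σval-run : ∀ k i → suc i < k → σval k i ≡ k ∸ 1 ∸ i
σval-run k i i+1<k rewrite +-comm i 1 | Equivalence.to T-≡ (<⇒<ᵇ i+1<k) = refl

¬T⇒≡false : ∀ {b} → ¬ T b → b ≡ false
¬T⇒≡false {false} _  = refl
¬T⇒≡false {true}  ¬t = ⊥-elim (¬t _)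

σval-peak : ∀ k → σval (suc k) k ≡ 2 + k
σval-peak k rewrite +-comm k 1
  | ¬T⇒≡false (<-irrefl refl ∘ <ᵇ⇒< (suc k) (suc k))
  | Equivalence.to T-≡ (≡⇒≡ᵇ k k refl) = refl

σval-last : ∀ k → σval k k ≡ k
σval-last k rewrite +-comm k 1
  | ¬T⇒≡false (<-asym (n<1+n k) ∘ <ᵇ⇒< (suc k) k)
  | ¬T⇒≡false (1+n≢n ∘ ≡ᵇ⇒≡ (suc k) k) = refl

-- Enumerating S_n(123, σ_k) along the generating tree

-- Gap p of a permutation of size n; the junk value 0 for p > n never occurs,
-- since labels never exceed n + 1.
position : ∀ n → ℕ → Fin (suc n)
position n p with p <? suc n
... | yes p<1+n = Fin.fromℕ< p<1+n
... | no  _     = 0F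

toℕ-position : ∀ n p → p < suc n → toℕ (position n p) ≡ p
toℕ-position n p p<1+n with p <? suc n
... | yes p<1+n′ = Fin.toℕ-fromℕ< p<1+n′
... | no  p≮1+n  = ⊥-elim (p≮1+n p<1+n)

-- Here k = 3 + d, and c = 2 + d is both the length of the run of σ_k and the cap.
module _ (d : ℕ) where

  private
    k c : ℕ
    k = 3 + d
    c = 2 + d

  σ-run : ∀ (a : Fin (2 + d)) → lookup (σ k) (inject₁ (inject₁ a)) ≡ 2 + d ∸ toℕ a
  σ-run a = trans (Vecₚ.lookup∘tabulate (λ i → σval k (toℕ i)) (inject₁ (inject₁ a)))
    (trans (cong (σval k) (toℕ-run a)) (σval-run k (toℕ a) (s≤s (toℕ<n a))))

  σ-peak : lookup (σ k) (inject₁ (fromℕ (2 + d))) ≡ 4 + d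
  σ-peak = trans (Vecₚ.lookup∘tabulate (λ i → σval k (toℕ i)) (inject₁ (fromℕ (2 + d))))
    (trans (cong (σval k) (toℕ-peak (2 + d))) (σval-peak (2 + d)))

  σ-last : lookup (σ k) (fromℕ (3 + d)) ≡ 3 + d
  σ-last = trans (Vecₚ.lookup∘tabulate (λ i → σval k (toℕ i)) (fromℕ (3 + d)))
    (trans (cong (σval k) (Fin.toℕ-fromℕ (3 + d))) (σval-last (3 + d)))

  runIndex : Fin (2 + d) → Fin (4 + d)
  runIndex a = inject₁ (inject₁ a)

  peakIndex lastIndex : Fin (4 + d)
  peakIndex = inject₁ (fromℕ (2 + d))
  lastIndex = fromℕ (3 + d)

  σ-run≤ : ∀ a → lookup (σ k) (runIndex a) ≤ 2 + d
  σ-run≤ a = subst (_≤ 2 + d) (sym (σ-run a)) (m∸n≤m (2 + d) (toℕ a))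

  σ≤peak : ∀ y → lookup (σ k) y ≤ 4 + d
  σ≤peak y with σposition y
  ... | run a = ≤-trans (σ-run≤ a) (≤-trans (n≤1+n _) (n≤1+n _))
  ... | peak  = ≤-reflexive σ-peak
  ... | last  = ≤-trans (≤-reflexive σ-last) (n≤1+n _)

  run<peak : ∀ a → runIndex a Fin.< peakIndex
  run<peak a = subst₂ _<_ (sym (toℕ-run a)) (sym (toℕ-peak (2 + d))) (toℕ<n a)

  peak<last : peakIndex Fin.< lastIndex
  peak<last = subst₂ _<_ (sym (toℕ-peak (2 + d))) (sym (Fin.toℕ-fromℕ (3 + d))) (n<1+n _)

  σ-injective : ∀ x y → lookup (σ k) x ≡ lookup (σ k) y → x ≡ y
  σ-injective x y σx≡σy with σposition x | σposition y
  ... | run a | run b = cong runIndex (Fin.toℕ-injective (∸-cancelˡ-≡ (<⇒≤ (toℕ<n a)) (<⇒≤ (toℕ<n b))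
                          (trans (sym (σ-run a)) (trans σx≡σy (σ-run b)))))
  ... | run a | peak  = ⊥-elim (<⇒≱ (≤-trans (n<1+n _) (n≤1+n _)) (subst (_≤ 2 + d) (trans σx≡σy σ-peak) (σ-run≤ a)))
  ... | run a | last  = ⊥-elim (<⇒≱ (n<1+n _) (subst (_≤ 2 + d) (trans σx≡σy σ-last) (σ-run≤ a)))
  ... | peak  | run b = ⊥-elim (<⇒≱ (≤-trans (n<1+n _) (n≤1+n _)) (subst (_≤ 2 + d) (trans (sym σx≡σy) σ-peak) (σ-run≤ b)))
  ... | peak  | peak  = refl
  ... | peak  | last  = ⊥-elim (1+n≢n (trans (sym σ-peak) (trans σx≡σy σ-last)))
  ... | last  | run b = ⊥-elim (<⇒≱ (n<1+n _) (subst (_≤ 2 + d) (trans (sym σx≡σy) σ-last) (σ-run≤ b)))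
  ... | last  | peak  = ⊥-elim (1+n≢n (trans (sym σ-peak) (trans (sym σx≡σy) σ-last)))
  ... | last  | last  = refl

  -- With the maximum inserted at p, the run, the maximum and later form σ_k.
  record DescentBefore {n} (π : Perm n) (p : Fin (suc n)) : Set where
    field
      runAt          : Fin (2 + d) → Fin n
      runAt-mono     : ∀ a b → a Fin.< b → runAt a Fin.< runAt b
      runAt<pivot    : ∀ a → toℕ (runAt a) < toℕ p
      runAt-descends : ∀ a b → a Fin.< b → val π (runAt b) < val π (runAt a)
      later          : Fin n
      pivot≤later    : toℕ p ≤ toℕ later
      run₀<later     : val π (runAt 0F) < val π later

  open DescentBefore

  throughσ⇒descentBefore : ∀ {n} (π : Perm n) p → OccurrenceThrough π (σ k) p → DescentBefore π p
  throughσ⇒descentBefore π p (f , (mono , iso) , i , fi≡p) with σposition i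
  ... | run a = ⊥-elim (<⇒≱ (subst₂ _<_ σ-peak (σ-run a) peak<run)
                             (≤-trans (m∸n≤m (2 + d) (toℕ a)) (≤-trans (n≤1+n _) (n≤1+n _))))
    where
    peak<run = occurrenceThrough-max π (σ k) p f (mono , iso) (runIndex a) fi≡p peakIndex λ eq → <-irrefl (cong toℕ (sym eq)) (run<peak a)
  ... | last  = ⊥-elim (<-asym (subst₂ _<_ σ-peak σ-last peak<last′) (n<1+n _))
    where
    peak<last′ = occurrenceThrough-max π (σ k) p f (mono , iso) lastIndex fi≡p peakIndex λ eq → <-irrefl (cong toℕ eq) peak<last
  ... | peak  = record
    { runAt          = λ a → index (e a)
    ; runAt-mono     = λ a b a<b → subst₂ _<_ (sym (toℕ-index (e a))) (sym (toℕ-index (e b)))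
                         (mono (runIndex a) (runIndex b) (subst₂ _<_ (sym (toℕ-run a)) (sym (toℕ-run b)) a<b))
    ; runAt<pivot    = λ a → index<pivot (e a)
    ; runAt-descends = λ a b a<b → subst₂ _<_ (sym (val-index (e b))) (sym (val-index (e a)))
                         (Equivalence.from (iso (runIndex b) (runIndex a))
                           (subst₂ _<_ (sym (σ-run b)) (sym (σ-run a)) (∸-monoʳ-< a<b (<⇒≤ (toℕ<n b)))))
    ; later          = EntryAfter.index e′
    ; pivot≤later    = EntryAfter.pivot≤index e′
    ; run₀<later     = subst₂ _<_ (sym (val-index (e 0F))) (sym (EntryAfter.val-index e′))
                         (Equivalence.from (iso (runIndex 0F) lastIndex) (subst₂ _<_ (sym (σ-run 0F)) (sym σ-last) (n<1+n _)))
    }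
    where
    e : ∀ a → EntryBefore π p (f (runIndex a))
    e a = entryBefore π p (f (runIndex a)) (subst (λ z → toℕ (f (runIndex a)) < toℕ z) fi≡p (mono (runIndex a) peakIndex (run<peak a)))
    e′ : EntryAfter π p (f lastIndex)
    e′ = entryAfter π p (f lastIndex) (subst (λ z → toℕ z < toℕ (f lastIndex)) fi≡p (mono peakIndex lastIndex peak<last))

  placeDescent : ∀ {n} {π : Perm n} {p} → DescentBefore π p → ∀ {x} → σPosition {2 + d} x → Fin (suc n)
  placeDescent {p = p} D (run a) = punchIn p (runAt D a)
  placeDescent {p = p} D peak    = p
  placeDescent {p = p} D last    = punchIn p (later D)

  descentPositions : ∀ {n} {π : Perm n} {p} → DescentBefore π p → Fin (4 + d) → Fin (suc n)
  descentPositions D x = placeDescent D (σposition x)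

  descentPositions-mono : ∀ {n} (π : Perm n) p (D : DescentBefore π p) →
    ∀ x y → x Fin.< y → descentPositions D x Fin.< descentPositions D y
  descentPositions-mono π p D x y x<y with σposition x | σposition y
  ... | run a | run b = subst₂ _<_ (sym (toℕ-punchIn-< p _ (runAt<pivot D a))) (sym (toℕ-punchIn-< p _ (runAt<pivot D b)))
                          (runAt-mono D a b (subst₂ _<_ (toℕ-run a) (toℕ-run b) x<y))
  ... | run a | peak  = subst (_< toℕ p) (sym (toℕ-punchIn-< p _ (runAt<pivot D a))) (runAt<pivot D a)
  ... | run a | last  = subst₂ _<_ (sym (toℕ-punchIn-< p _ (runAt<pivot D a))) (sym (toℕ-punchIn-≥ p _ (pivot≤later D)))
                          (<-≤-trans (runAt<pivot D a) (m≤n⇒m≤1+n (pivot≤later D)))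
  ... | peak  | run b = ⊥-elim (<-asym (subst₂ _<_ (toℕ-peak (2 + d)) (toℕ-run b) x<y) (toℕ<n b))
  ... | peak  | peak  = ⊥-elim (<-irrefl refl x<y)
  ... | peak  | last  = subst (toℕ p <_) (sym (toℕ-punchIn-≥ p _ (pivot≤later D))) (s≤s (pivot≤later D))
  ... | last  | _     = ⊥-elim (<-irrefl refl (<-≤-trans (subst (_< toℕ y) (Fin.toℕ-fromℕ (3 + d)) x<y) (≤-pred (toℕ<n y))))

  descentPositions-values : ∀ {n} (π : Perm n) p (D : DescentBefore π p) → ∀ x y → lookup (σ k) x < lookup (σ k) y →
    val (insertMax π p) (descentPositions D x) < val (insertMax π p) (descentPositions D y)
  descentPositions-values π p D x y σx<σy with σposition x | σposition y
  ... | run a | run b = subst₂ _<_ (sym (val-insertMax-punchIn π p _)) (sym (val-insertMax-punchIn π p _))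
                          (runAt-descends D b a (≰⇒> λ a≤b →
                            <⇒≱ (subst₂ _<_ (σ-run a) (σ-run b) σx<σy) (∸-monoʳ-≤ (2 + d) a≤b)))
  ... | run a | peak  = subst₂ _<_ (sym (val-insertMax-punchIn π p _)) (sym (val-insertMax-at π p)) (val< π _)
  ... | run a | last  = subst₂ _<_ (sym (val-insertMax-punchIn π p _)) (sym (val-insertMax-punchIn π p _))
                          (≤-<-trans (run≤run₀ a) (run₀<later D))
    where
    run≤run₀ : ∀ a → val π (runAt D a) ≤ val π (runAt D 0F)
    run≤run₀ 0F          = ≤-refl
    run≤run₀ (Fin.suc a) = <⇒≤ (runAt-descends D 0F (Fin.suc a) z<s)
  ... | peak  | _     = ⊥-elim (<⇒≱ (subst (_< lookup (σ k) y) σ-peak σx<σy) (σ≤peak y))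
  ... | last  | run b = ⊥-elim (<⇒≱ (subst₂ _<_ σ-last (σ-run b) σx<σy) (≤-trans (m∸n≤m (2 + d) (toℕ b)) (n≤1+n _)))
  ... | last  | peak  = subst₂ _<_ (sym (val-insertMax-punchIn π p _)) (sym (val-insertMax-at π p)) (val< π _)
  ... | last  | last  = ⊥-elim (<-irrefl refl σx<σy)

  descentBefore⇒containsσ : ∀ {n} (π : Perm n) p → DescentBefore π p → Contains (insertMax π p) (σ k)
  descentBefore⇒containsσ π p D =
    descentPositions D , descentPositions-mono π p D ,
    order-iso (λ x → val (insertMax π p) (descentPositions D x)) (σ k) (descentPositions-values π p D) σ-injective

  descentBefore-insertMax₀⁺ : ∀ {n} (π : Perm n) q → DescentBefore π q → DescentBefore (insertMax π 0F) (Fin.suc q)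
  descentBefore-insertMax₀⁺ π q D = record
    { runAt          = λ a → Fin.suc (runAt D a)
    ; runAt-mono     = λ a b a<b → s≤s (runAt-mono D a b a<b)
    ; runAt<pivot    = λ a → s≤s (runAt<pivot D a)
    ; runAt-descends = λ a b a<b → subst₂ _<_ (sym (val₀ (runAt D b))) (sym (val₀ (runAt D a))) (runAt-descends D a b a<b)
    ; later          = Fin.suc (later D)
    ; pivot≤later    = s≤s (pivot≤later D)
    ; run₀<later     = subst₂ _<_ (sym (val₀ (runAt D 0F))) (sym (val₀ (later D))) (run₀<later D)
    }
    where
    val₀ = val-insertMax-punchIn π 0F

  descentBefore-insertMax₀⁻ : ∀ {n} (π : Perm n) q → DescentBefore (insertMax π 0F) (Fin.suc q) → DescentBefore π q
  descentBefore-insertMax₀⁻ π q D with later D | pivot≤later D | run₀<later D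
  ... | Fin.suc b | s≤s q≤b | run₀<b = record
    { runAt          = runAt′
    ; runAt-mono     = λ a b a<b → ≤-pred (subst₂ _<_ (toℕ-runAt a) (toℕ-runAt b) (runAt-mono D a b a<b))
    ; runAt<pivot    = λ a → ≤-pred (subst (_< suc (toℕ q)) (toℕ-runAt a) (runAt<pivot D a))
    ; runAt-descends = λ a b a<b → subst₂ _<_ (val-runAt b) (val-runAt a) (runAt-descends D a b a<b)
    ; later          = b
    ; pivot≤later    = q≤b
    ; run₀<later     = subst₂ _<_ (val-runAt 0F) (val-insertMax-punchIn π 0F b) run₀<b
    }
    where
    run₀≢0 : runAt D 0F ≢ 0F
    run₀≢0 run₀≡0 = <-asym (subst₂ _<_ (trans (cong (val (insertMax π 0F)) run₀≡0) (val-insertMax-at π 0F))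
                                         (val-insertMax-punchIn π 0F b) run₀<b) (val< π b)
    positive : ∀ a → 0 < toℕ (runAt D a)
    positive 0F          = n≢0⇒n>0 (run₀≢0 ∘ Fin.toℕ-injective)
    positive (Fin.suc a) = <-trans (positive 0F) (runAt-mono D 0F (Fin.suc a) z<s)
    predecessor : ∀ (x : Fin (suc _)) → 0 < toℕ x → ∃ λ y → Fin.suc y ≡ x
    predecessor (Fin.suc y) _ = y , refl
    runAt′ : Fin (2 + d) → Fin _
    runAt′ a = proj₁ (predecessor (runAt D a) (positive a))
    suc-runAt′ : ∀ a → Fin.suc (runAt′ a) ≡ runAt D a
    suc-runAt′ a = proj₂ (predecessor (runAt D a) (positive a))
    toℕ-runAt : ∀ a → toℕ (runAt D a) ≡ suc (toℕ (runAt′ a))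
    toℕ-runAt a = cong toℕ (sym (suc-runAt′ a))
    val-runAt : ∀ a → val (insertMax π 0F) (runAt D a) ≡ val π (runAt′ a)
    val-runAt a = trans (cong (val (insertMax π 0F)) (sym (suc-runAt′ a))) (val-insertMax-punchIn π 0F (runAt′ a))

  Active : ∀ {n} → Perm n → Fin (suc n) → Set
  Active π p = ¬ AscentBefore π p × ¬ DescentBefore π p

  insertMax-InS : ∀ {n} (π : Perm n) p → InS k n π → Active π p → InS k (suc n) (insertMax π p)
  insertMax-InS π p (πinj , avoids123 , avoidsσ) (noAscent , noDescent) =
    insertMax-IsPerm π p πinj , avoids123′ , avoidsσ′
    where
    avoids123′ : Avoids (insertMax π p) p123
    avoids123′ c with insertMax-Contains⁻ π p123 p c
    ... | inj₁ c′      = avoids123 c′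
    ... | inj₂ through = noAscent (through123⇒ascentBefore π p through)
    avoidsσ′ : Avoids (insertMax π p) (σ k)
    avoidsσ′ c with insertMax-Contains⁻ π (σ k) p c
    ... | inj₁ c′      = avoidsσ c′
    ... | inj₂ through = noDescent (throughσ⇒descentBefore π p through)

  InS-insertMax⇒Active : ∀ {n} (π : Perm n) p → InS k (suc n) (insertMax π p) → Active π p
  InS-insertMax⇒Active π p (_ , avoids123 , avoidsσ) =
    (λ A → avoids123 (ascentBefore⇒contains123 π p A)) , (λ D → avoidsσ (descentBefore⇒containsσ π p D))

  InS-removeMax : ∀ {n} (π′ : Perm (suc n)) → InS k (suc n) π′ →
    Σ (Perm n) λ π → ∃ λ p → insertMax π p ≡ π′ × InS k n π
  InS-removeMax π′ (π′inj , avoids123 , avoidsσ) with removeMax π′ π′inj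
  ... | π , p , refl , πinj =
    π , p , refl , πinj , (λ c → avoids123 (insertMax-Contains⁺ π p123 p c)) , (λ c → avoidsσ (insertMax-Contains⁺ π (σ k) p c))

  record HasLabel {n} (π : Perm n) (j : ℕ) : Set where
    field
      label≤        : j ≤ suc n
      active⇒<label : ∀ p → Active π p → toℕ p < j
      <label⇒active : ∀ p → toℕ p < j → Active π p

  open HasLabel

  label-empty : HasLabel [] 1
  label-empty = record
    { label≤        = s≤s z≤n
    ; active⇒<label = λ { 0F _ → z<s }
    ; <label⇒active = λ { 0F _ → (λ { (() , _) }) , (λ D → Fin.¬Fin0 (runAt D 0F)) }
    }

  -- A maximum in front takes part in neither pattern, so gap q + 1 behaves like gap q of π.
  label-insertMax₀ : ∀ {n} (π : Perm n) {j} → HasLabel π j → HasLabel (insertMax π 0F) (suc j)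
  label-insertMax₀ π L = record
    { label≤        = s≤s (label≤ L)
    ; active⇒<label = active⇒<
    ; <label⇒active = <⇒active
    }
    where
    active⇒< : ∀ q → Active (insertMax π 0F) q → toℕ q < suc _
    active⇒< 0F          _ = z<s
    active⇒< (Fin.suc q) (noA , noD) = s≤s (active⇒<label L q
      ((λ A → noA (ascentBefore-insertMax₀⁺ π q A)) , (λ D → noD (descentBefore-insertMax₀⁺ π q D))))
    <⇒active : ∀ q → toℕ q < suc _ → Active (insertMax π 0F) q
    <⇒active 0F          _       = (λ { (_ , _ , _ , () , _) }) , (λ D → n≮0 (runAt<pivot D 0F))
    <⇒active (Fin.suc q) (s≤s q<j) =
      (λ A → proj₁ (<label⇒active L q q<j) (ascentBefore-insertMax₀⁻ π q A)) ,
      (λ D → proj₂ (<label⇒active L q q<j) (descentBefore-insertMax₀⁻ π q D))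

  descentThroughPivot : ∀ {n} (π : Perm n) p q → IsPerm π → ¬ AscentBefore π p →
    toℕ q ≤ toℕ p → 2 + d ≤ toℕ q → DescentBefore (insertMax π p) q
  descentThroughPivot {n} π p q πinj noAscent q≤p run≤q = record
    { runAt          = slot
    ; runAt-mono     = λ a b a<b → subst₂ _<_ (sym (toℕ-slot a)) (sym (toℕ-slot b)) a<b
    ; runAt<pivot    = λ a → subst (_< toℕ q) (sym (toℕ-slot a)) (<-≤-trans (toℕ<n a) run≤q)
    ; runAt-descends = λ a b a<b → subst₂ _<_ (val-index (e b)) (val-index (e a))
        (noAscent⇒descending π p πinj noAscent (index (e a)) (index (e b))
          (subst₂ _<_ (sym (trans (toℕ-index (e a)) (toℕ-slot a))) (sym (trans (toℕ-index (e b)) (toℕ-slot b))) a<b)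
          (index<pivot (e b)))
    ; later          = p
    ; pivot≤later    = q≤p
    ; run₀<later     = subst₂ _<_ (val-index (e 0F)) (sym (val-insertMax-at π p)) (val< π (index (e 0F)))
    }
    where
    a<p : ∀ (a : Fin (2 + d)) → toℕ a < toℕ p
    a<p a = <-≤-trans (toℕ<n a) (≤-trans run≤q q≤p)
    slot : Fin (2 + d) → Fin (suc n)
    slot a = Fin.fromℕ< (<-trans (a<p a) (toℕ<n p))
    toℕ-slot : ∀ a → toℕ (slot a) ≡ toℕ a
    toℕ-slot a = Fin.toℕ-fromℕ< (<-trans (a<p a) (toℕ<n p))
    e : ∀ a → EntryBefore π p (slot a)
    e a = entryBefore π p (slot a) (subst (_< toℕ p) (sym (toℕ-slot a)) (a<p a))

  activeBeforeRunLength : ∀ {n} (π : Perm n) p q → Active π p →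
    toℕ q ≤ toℕ p → toℕ q ≤ suc d → Active (insertMax π p) q
  activeBeforeRunLength π p q (noAscent , _) q≤p q≤1+d = noAscent′ , noDescent′
    where
    noAscent′ : ¬ AscentBefore (insertMax π p) q
    noAscent′ (i , i′ , i<i′ , i′<q , πi<πi′) = noAscent
      (index eᵢ , index eᵢ′ , subst₂ _<_ (sym (toℕ-index eᵢ)) (sym (toℕ-index eᵢ′)) i<i′ , index<pivot eᵢ′ ,
       subst₂ _<_ (sym (val-index eᵢ)) (sym (val-index eᵢ′)) πi<πi′)
      where
      eᵢ  = entryBefore π p i (<-≤-trans (<-trans i<i′ i′<q) q≤p)
      eᵢ′ = entryBefore π p i′ (<-≤-trans i′<q q≤p)
    noDescent′ : ¬ DescentBefore (insertMax π p) q
    noDescent′ D = <-irrefl refl (≤-<-trans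
      (≤-trans (≤-reflexive (sym (Fin.toℕ-fromℕ (suc d)))) (strictlyIncreasing⇒≤ (runAt D) (runAt-mono D) (fromℕ (suc d))))
      (<-≤-trans (runAt<pivot D (fromℕ (suc d))) q≤1+d))

  -- Gaps after p see the ascent (π 0, maximum).  Gaps at or before p see the
  -- descending run π 0 > π 1 > ⋯, which is followed by the maximum, so they
  -- are active iff fewer than 2 + d entries precede them.
  label-insertMax-suc : ∀ {n} (π : Perm n) {j} → IsPerm π → HasLabel π j → ∀ p p′ → toℕ p ≡ suc p′ → suc p′ < j →
    HasLabel (insertMax π p) ((2 + d) ⊓ (2 + p′))
  label-insertMax-suc {n} π {j} πinj L p p′ p≡1+p′ p<j = record
    { label≤        = ≤-trans (m⊓n≤n (2 + d) (2 + p′)) (s≤s (≤-trans (subst (_≤ n) p≡1+p′ (≤-pred (toℕ<n p))) (n≤1+n n)))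
    ; active⇒<label = active⇒<
    ; <label⇒active = λ q q<label → activeBeforeRunLength π p q activeP
        (subst (toℕ q ≤_) (sym p≡1+p′) (≤-pred (m<n⊓o⇒m<o (2 + d) _ q<label))) (≤-pred (m<n⊓o⇒m<n (2 + d) _ q<label))
    }
    where
    activeP : Active π p
    activeP = <label⇒active L p (subst (_< j) (sym p≡1+p′) p<j)
    active⇒< : ∀ q → Active (insertMax π p) q → toℕ q < (2 + d) ⊓ (2 + p′)
    active⇒< q (noA , noD) with toℕ p <? toℕ q
    ... | yes p<q = ⊥-elim (noA (ascentThroughPivot π p q (subst (0 <_) (sym p≡1+p′) z<s) p<q))
    ... | no  p≮q with 2 + d ≤? toℕ q
    ...   | yes run≤q = ⊥-elim (noD (descentThroughPivot π p q πinj (proj₁ activeP) (≮⇒≥ p≮q) run≤q))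
    ...   | no  run≰q = ⊓-glb (≰⇒> run≰q) (s≤s (subst (toℕ q ≤_) p≡1+p′ (≮⇒≥ p≮q)))

  Node : ℕ → Set
  Node n = Perm n × ℕ

  children : ∀ {n} → Node n → List (Node (suc n))
  children {n} (π , j) = map (λ p → insertMax π (position n p) , child c j p) (upTo j)

  level : (n : ℕ) → List (Node n)
  level zero    = [ [] , 1 ]
  level (suc n) = concatMap children (level n)

  Labelled : ∀ {n} → Node n → Set
  Labelled {n} (π , j) = InS k n π × HasLabel π j

  children-Labelled : ∀ {n} (x : Node n) → Labelled x → ∀ y → y ∈ children x → Labelled y
  children-Labelled {n} (π , j) (inS , L) y y∈ with ∈-map⁻ _ y∈
  ... | p , p∈upTo , refl =
    insertMax-InS π (position n p) inS (<label⇒active L (position n p) (subst (_< j) (sym (toℕ-pos p<j)) p<j)) ,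
    childLabel p p<j
    where
    p<j = ∈-upTo⁻ p∈upTo
    toℕ-pos : ∀ {p} → p < j → toℕ (position n p) ≡ p
    toℕ-pos p<j = toℕ-position n _ (<-≤-trans p<j (label≤ L))
    childLabel : ∀ p → p < j → HasLabel (insertMax π (position n p)) (child c j p)
    childLabel zero    p<j = subst (λ q → HasLabel (insertMax π q) (suc j)) (sym (Fin.toℕ-injective {j = 0F} (toℕ-pos p<j)))
                                   (label-insertMax₀ π L)
    childLabel (suc p) p<j = label-insertMax-suc π (proj₁ inS) L (position n (suc p)) p (toℕ-pos p<j) p<j

  level-Labelled : ∀ n x → x ∈ level n → Labelled x
  level-Labelled zero    x (here refl) = InS-empty , label-empty
    where
    InS-empty : InS k 0 []
    InS-empty = (λ ()) , (λ (f , _) → Fin.¬Fin0 (f 0F)) , (λ (f , _) → Fin.¬Fin0 (f 0F))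
  level-Labelled (suc n) x x∈ with find (∈-concatMap⁻ children x∈)
  ... | y , y∈ , x∈children = children-Labelled y (level-Labelled n y y∈) x x∈children

  level-complete : ∀ n (π : Perm n) → InS k n π → ∃ λ j → (π , j) ∈ level n
  level-complete zero    []  _   = 1 , here refl
  level-complete (suc n) π′ inS with InS-removeMax π′ inS
  ... | π , p , refl , inSπ with level-complete n π inSπ
  ...   | j , πj∈level = child c j (toℕ p) , ∈-concatMap⁺ children (lose πj∈level π′∈children)
    where
    p<j : toℕ p < j
    p<j = active⇒<label (proj₂ (level-Labelled n (π , j) πj∈level)) p (InS-insertMax⇒Active π p inS)
    position-toℕ : position n (toℕ p) ≡ p
    position-toℕ = Fin.toℕ-injective (toℕ-position n (toℕ p) (Fin.toℕ<n p))
    π′∈children : (insertMax π p , child c j (toℕ p)) ∈ children (π , j)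
    π′∈children = subst (λ q → (insertMax π q , child c j (toℕ p)) ∈ children (π , j)) position-toℕ
      (∈-map⁺ (λ q → insertMax π (position n q) , child c j q) (∈-upTo⁺ p<j))

  ∈-children⁻ : ∀ {n} {π : Perm n} {j} {τ} → τ ∈ map proj₁ (children (π , j)) → ∃ λ q → τ ≡ insertMax π q
  ∈-children⁻ {n} τ∈ with ∈-map⁻ proj₁ τ∈
  ... | y , y∈children , refl with ∈-map⁻ _ y∈children
  ...   | p , _ , refl = position n p , refl

  level-unique : ∀ n → Unique (map proj₁ (level n))
  level-unique zero    = [] ∷ []
  level-unique (suc n) = subst Unique (sym (map-concatMap proj₁ children (level n)))
    (unique-concatMap (map proj₁ ∘ children) proj₁ (level n) (level-unique n) siblings-unique parents-agree)
    where
    siblings-unique : ∀ x → x ∈ level n → Unique (map proj₁ (children x))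
    siblings-unique (π , j) x∈ = subst Unique (map-∘ (upTo j))
      (unique-map (λ p → insertMax π (position n p)) (upTo j) (Unique.upTo⁺ j) λ a b a∈ b∈ eq →
        trans (sym (toℕ-pos a∈)) (trans (cong toℕ (insertMax-injectiveˡ π π _ _ eq)) (toℕ-pos b∈)))
      where
      toℕ-pos : ∀ {p} → p ∈ upTo j → toℕ (position n p) ≡ p
      toℕ-pos p∈ = toℕ-position n _ (<-≤-trans (∈-upTo⁻ p∈) (label≤ (proj₂ (level-Labelled n (π , j) x∈))))
    parents-agree : ∀ x y τ → x ∈ level n → y ∈ level n →
      τ ∈ map proj₁ (children x) → τ ∈ map proj₁ (children y) → proj₁ x ≡ proj₁ y
    parents-agree (π , _) (π′ , _) τ _ _ τ∈x τ∈y with ∈-children⁻ τ∈x | ∈-children⁻ τ∈y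
    ... | q , refl | q′ , eq with insertMax-injectiveˡ π π′ q q′ eq
    ...   | refl = insertMax-injectiveʳ π π′ q eq

  children-weight : ∀ {n} t (x : Node n) → sum (map (descendants c t ∘ proj₂) (children x)) ≡ descendants c (suc t) (proj₂ x)
  children-weight t (π , j) =
    trans (cong sum (sym (map-∘ (upTo j)))) (sum-map-applyUpTo (λ p → descendants c t (child c j p)) (λ p → p) j)

  level-weight : ∀ n t → sum (map (descendants c t ∘ proj₂) (level n)) ≡ levelSize c (n + t)
  level-weight zero    t = +-identityʳ (levelSize c t)
  level-weight (suc n) t = begin
    sum (map (descendants c t ∘ proj₂) (concatMap children (level n)))
      ≡⟨ sum-map-concatMap (descendants c t ∘ proj₂) children (level n) ⟩
    sum (map (sum ∘ map (descendants c t ∘ proj₂) ∘ children) (level n))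
      ≡⟨ cong sum (map-cong (children-weight t) (level n)) ⟩
    sum (map (descendants c (suc t) ∘ proj₂) (level n))
      ≡⟨ level-weight n (suc t) ⟩
    levelSize c (n + suc t)
      ≡⟨ cong (levelSize c) (+-suc n t) ⟩
    levelSize c (suc n + t) ∎

  length-level : ∀ n → length (map proj₁ (level n)) ≡ levelSize c n
  length-level n = begin
    length (map proj₁ (level n))                          ≡⟨ length-map proj₁ (level n) ⟩
    length (level n)                                      ≡⟨ length≡sum-map-1 (level n) ⟩
    sum (map (descendants c 0 ∘ proj₂) (level n))         ≡⟨ level-weight n 0 ⟩
    levelSize c (n + 0)                                   ≡⟨ cong (levelSize c) (+-identityʳ n) ⟩
    levelSize c n                                         ∎

  InS-count : ∀ n m → HasSize (InS k n) m → m ≡ levelSize c n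
  InS-count n m size = HasSize-unique size
    (map proj₁ (level n) , level-unique n , length-level n , λ π → mk⇔ (sound π) (complete π))
    where
    sound : ∀ π → π ∈ map proj₁ (level n) → InS k n π
    sound π π∈ with ∈-map⁻ proj₁ π∈
    ... | x , x∈ , refl = proj₁ (level-Labelled n x x∈)
    complete : ∀ π → InS k n π → π ∈ map proj₁ (level n)
    complete π inS = ∈-map⁺ proj₁ (proj₂ (level-complete n π inS))

HasSize-InS⇒levelSize : ∀ k n {m} → 3 ≤ k → HasSize (InS k n) m → m ≡ levelSize (k ∸ 1) n
HasSize-InS⇒levelSize (suc (suc (suc d))) n (s≤s (s≤s (s≤s _))) = InS-count d n _

-- Power series

-- Opened only here: ℤ's +_ would make the ℕ sections (x +_) above ambiguous.
open import Data.Integer using (+_; -[1+_])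

sumTo-cong : ∀ n {f g : ℕ → ℤ} → (∀ i → i ≤ n → f i ≡ g i) → sumTo f n ≡ sumTo g n
sumTo-cong zero    f≡g = f≡g 0 z≤n
sumTo-cong (suc n) f≡g =
  cong₂ ℤ._+_ (sumTo-cong n (λ i i≤n → f≡g i (m≤n⇒m≤1+n i≤n))) (f≡g (suc n) ≤-refl)

sumTo-pos : ∀ (f : ℕ → ℕ) n → sumTo (λ i → + f i) n ≡ + Σ< (suc n) f
sumTo-pos f zero    = refl
sumTo-pos f (suc n) =
  trans (cong (ℤ._+ + f (suc n)) (sumTo-pos f n)) (sym (ℤ.pos-+ (Σ< (suc n) f) (f (suc n))))

sumTo-neg : ∀ n (f : ℕ → ℤ) → sumTo (λ i → ℤ.- f i) n ≡ ℤ.- sumTo f n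
sumTo-neg zero    f = refl
sumTo-neg (suc n) f =
  trans (cong (ℤ._+ ℤ.- f (suc n)) (sumTo-neg n f)) (sym (ℤ.neg-distrib-+ (sumTo f n) (f (suc n))))

sumTo-unfoldˡ : ∀ n (f : ℕ → ℤ) → sumTo f (suc n) ≡ f 0 ℤ.+ sumTo (λ i → f (suc i)) n
sumTo-unfoldˡ zero    f = refl
sumTo-unfoldˡ (suc n) f = trans (cong (ℤ._+ f (2 + n)) (sumTo-unfoldˡ n f)) (ℤ.+-assoc (f 0) _ _)

sumTo-zero : ∀ n → sumTo (λ _ → + 0) n ≡ + 0
sumTo-zero zero    = refl
sumTo-zero (suc n) = cong (ℤ._+ + 0) (sumTo-zero n)

X⋆-suc : ∀ (h : FPS) m → (X ⋆ h) (suc m) ≡ h m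
X⋆-suc h m = trans (sumTo-unfoldˡ m _) (trans (ℤ.+-identityˡ _) (shifted m))
  where
  shifted : ∀ m → sumTo (λ i → X (suc i) ℤ.* h (m ∸ i)) m ≡ h m
  shifted zero    = ℤ.*-identityˡ (h 0)
  shifted (suc m) = begin
    sumTo (λ i → X (suc i) ℤ.* h (suc m ∸ i)) (suc m)
      ≡⟨ sumTo-unfoldˡ m _ ⟩
    + 1 ℤ.* h (suc m) ℤ.+ sumTo (λ i → X (2 + i) ℤ.* h (m ∸ i)) m
      ≡⟨ cong₂ ℤ._+_ (ℤ.*-identityˡ (h (suc m))) (sumTo-zero m) ⟩
    h (suc m) ℤ.+ + 0
      ≡⟨ ℤ.+-identityʳ _ ⟩
    h (suc m) ∎

one⊖X⋆-suc : ∀ (h : FPS) t → (one ⊖ (X ⋆ h)) (suc t) ≡ ℤ.- h t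
one⊖X⋆-suc h t = trans (cong (λ x → + 0 ℤ.- x) (X⋆-suc h t)) (ℤ.+-identityˡ (ℤ.- h t))

⋆-cong : ∀ {f f′ h h′ : FPS} → (∀ i → f i ≡ f′ i) → (∀ i → h i ≡ h′ i) → ∀ n → (f ⋆ h) n ≡ (f′ ⋆ h′) n
⋆-cong f≗f′ h≗h′ n = sumTo-cong n (λ i _ → cong₂ ℤ._*_ (f≗f′ i) (h≗h′ (n ∸ i)))

one⊖X⋆-cong : ∀ {h h′ : FPS} → (∀ i → h i ≡ h′ i) → ∀ i → (one ⊖ (X ⋆ h)) i ≡ (one ⊖ (X ⋆ h′)) i
one⊖X⋆-cong h≗h′ i = cong (ℤ._-_ (one i)) (⋆-cong {f = X} (λ _ → refl) h≗h′ i)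

convolutionRecurrence⇒g⋆[1-Xh]≡1 : (g h : ℕ → ℕ) → g 0 ≡ 1 →
  (∀ m → g (suc m) ≡ Σ< (suc m) (λ i → g i * h (m ∸ i))) →
  ∀ n → ((λ i → + g i) ⋆ (one ⊖ (X ⋆ (λ i → + h i)))) n ≡ one n
convolutionRecurrence⇒g⋆[1-Xh]≡1 g h g0≡1 rec zero rewrite g0≡1 = refl
convolutionRecurrence⇒g⋆[1-Xh]≡1 g h g0≡1 rec (suc m) = begin
  sumTo (λ i → G i ℤ.* U (suc m ∸ i)) m ℤ.+ G (suc m) ℤ.* U (m ∸ m)
    ≡⟨ cong (λ t → sumTo (λ i → G i ℤ.* U (suc m ∸ i)) m ℤ.+ G (suc m) ℤ.* U t) (n∸n≡0 m) ⟩
  sumTo (λ i → G i ℤ.* U (suc m ∸ i)) m ℤ.+ G (suc m) ℤ.* + 1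
    ≡⟨ cong₂ ℤ._+_ (sumTo-cong m term) (ℤ.*-identityʳ (G (suc m))) ⟩
  sumTo (λ i → ℤ.- + (g i * h (m ∸ i))) m ℤ.+ G (suc m)
    ≡⟨ cong (ℤ._+ G (suc m)) (sumTo-neg m _) ⟩
  ℤ.- sumTo (λ i → + (g i * h (m ∸ i))) m ℤ.+ G (suc m)
    ≡⟨ cong (λ s → ℤ.- s ℤ.+ G (suc m)) (sumTo-pos (λ i → g i * h (m ∸ i)) m) ⟩
  ℤ.- + Σ< (suc m) (λ i → g i * h (m ∸ i)) ℤ.+ G (suc m)
    ≡⟨ cong (λ s → ℤ.- + s ℤ.+ G (suc m)) (rec m) ⟨
  ℤ.- G (suc m) ℤ.+ G (suc m)
    ≡⟨ ℤ.+-inverseˡ (G (suc m)) ⟩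
  + 0 ∎
  where
  G H U : FPS
  G i = + g i
  H i = + h i
  U = one ⊖ (X ⋆ H)
  term : ∀ i → i ≤ m → G i ℤ.* U (suc m ∸ i) ≡ ℤ.- + (g i * h (m ∸ i))
  term i i≤m = begin
    G i ℤ.* U (suc m ∸ i)      ≡⟨ cong (λ t → G i ℤ.* U t) (+-∸-assoc 1 i≤m) ⟩
    G i ℤ.* U (suc (m ∸ i))    ≡⟨ cong (G i ℤ.*_) (one⊖X⋆-suc H (m ∸ i)) ⟩
    G i ℤ.* ℤ.- H (m ∸ i)      ≡⟨ ℤ.neg-distribʳ-* (G i) (H (m ∸ i)) ⟨
    ℤ.- (G i ℤ.* H (m ∸ i))    ≡⟨ cong ℤ.-_ (ℤ.pos-* (g i) (h (m ∸ i))) ⟨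
    ℤ.- + (g i * h (m ∸ i))    ∎

threeTermRecurrence⇒g⋆[1-3X+X²]≡1-2X : (g : ℕ → ℕ) → g 0 ≡ 1 → g 1 ≡ 1 →
  (∀ m → g (2 + m) + g m ≡ 3 * g (1 + m)) →
  ∀ n → ((λ i → + g i) ⋆ poly (+ 1 ∷ -[1+ 2 ] ∷ + 1 ∷ [])) n ≡ poly (+ 1 ∷ -[1+ 1 ] ∷ []) n
threeTermRecurrence⇒g⋆[1-3X+X²]≡1-2X g g0≡1 g1≡1 rec zero          rewrite g0≡1         = refl
threeTermRecurrence⇒g⋆[1-3X+X²]≡1-2X g g0≡1 g1≡1 rec (suc zero)    rewrite g0≡1 | g1≡1 = refl
threeTermRecurrence⇒g⋆[1-3X+X²]≡1-2X g g0≡1 g1≡1 rec (suc (suc m)) = begin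
  sumTo f m ℤ.+ f (1 + m) ℤ.+ f (2 + m)
    ≡⟨ cong₂ (λ s t → s ℤ.+ G (1 + m) ℤ.* P t ℤ.+ f (2 + m)) (leading m) (m+n∸n≡m 1 m) ⟩
  G m ℤ.+ G (1 + m) ℤ.* P 1 ℤ.+ G (2 + m) ℤ.* P (m ∸ m)
    ≡⟨ cong (λ t → G m ℤ.+ G (1 + m) ℤ.* P 1 ℤ.+ G (2 + m) ℤ.* P t) (n∸n≡0 m) ⟩
  G m ℤ.+ G (1 + m) ℤ.* P 1 ℤ.+ G (2 + m) ℤ.* P 0
    ≡⟨ expand (G m) (G (1 + m)) (G (2 + m)) ⟩
  (G (2 + m) ℤ.+ G m) ℤ.- + 3 ℤ.* G (1 + m)
    ≡⟨ cong₂ ℤ._-_ (ℤ.pos-+ (g (2 + m)) (g m)) (ℤ.pos-* 3 (g (1 + m))) ⟨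
  + (g (2 + m) + g m) ℤ.- + (3 * g (1 + m))
    ≡⟨ cong (λ s → + s ℤ.- + (3 * g (1 + m))) (rec m) ⟩
  + (3 * g (1 + m)) ℤ.- + (3 * g (1 + m))
    ≡⟨ ℤ.+-inverseʳ (+ (3 * g (1 + m))) ⟩
  + 0 ∎
  where
  G P : FPS
  G i = + g i
  P = poly (+ 1 ∷ -[1+ 2 ] ∷ + 1 ∷ [])
  f : ℕ → ℤ
  f i = G i ℤ.* P (2 + m ∸ i)
  expand : ∀ x y z → x ℤ.+ y ℤ.* P 1 ℤ.+ z ℤ.* P 0 ≡ (z ℤ.+ x) ℤ.- + 3 ℤ.* y
  expand = ℤ-solve-∀
  leading : ∀ m → sumTo (λ i → G i ℤ.* P (2 + m ∸ i)) m ≡ G m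
  leading zero    = ℤ.*-identityʳ (G 0)
  leading (suc k) = begin
    sumTo (λ i → G i ℤ.* P (3 + k ∸ i)) k ℤ.+ G (suc k) ℤ.* P (2 + k ∸ k)
      ≡⟨ cong₂ ℤ._+_ (sumTo-cong k beyond) (cong (λ t → G (suc k) ℤ.* P t) (m+n∸n≡m 2 k)) ⟩
    sumTo (λ _ → + 0) k ℤ.+ G (suc k) ℤ.* + 1
      ≡⟨ cong₂ ℤ._+_ (sumTo-zero k) (ℤ.*-identityʳ (G (suc k))) ⟩
    G (suc k) ∎
    where
    beyond : ∀ i → i ≤ k → G i ℤ.* P (3 + k ∸ i) ≡ + 0
    beyond i i≤k = trans (cong (λ t → G i ℤ.* P t) (+-∸-assoc 3 i≤k)) (ℤ.*-zeroʳ (G i))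

levelSize₂-generatingFunction : ∀ n →
  ((λ i → + levelSize 2 i) ⋆ poly (+ 1 ∷ -[1+ 2 ] ∷ + 1 ∷ [])) n ≡ poly (+ 1 ∷ -[1+ 1 ] ∷ []) n
levelSize₂-generatingFunction = threeTermRecurrence⇒g⋆[1-3X+X²]≡1-2X (levelSize 2) refl refl levelSize₂-recurrence

levelSize-generatingFunction : ∀ e n →
  ((λ i → + levelSize (3 + e) i) ⋆ (one ⊖ (X ⋆ λ i → + levelSize (2 + e) i))) n ≡ one n
levelSize-generatingFunction e = convolutionRecurrence⇒g⋆[1-Xh]≡1 (levelSize (3 + e)) (levelSize (2 + e)) refl
  λ m → trans (levelSize-convolution (suc e) m) (Σ<-convolution-comm m (levelSize (2 + e)) (levelSize (3 + e)))

catalanGF-equation : ∀ n → (catalanGF ⋆ (one ⊖ (X ⋆ catalanGF))) n ≡ one n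
catalanGF-equation = convolutionRecurrence⇒g⋆[1-Xh]≡1 catalan catalan refl catalan-convolution

mainTheorem3 : (a : ℕ → ℕ → ℕ) →
    ((k n : ℕ) → 3 ≤ k → HasSize (InS k n) (a k n)) →
    let g : ℕ → FPS
        g k n = + (a k n)
    in ((n : ℕ) → (g 3 ⋆ poly (+ 1 ∷ -[1+ 2 ] ∷ + 1 ∷ [])) n ≡ poly (+ 1 ∷ -[1+ 1 ] ∷ []) n)
       × ((k : ℕ) → 4 ≤ k → (n : ℕ) → (g k ⋆ (one ⊖ (X ⋆ g (k ∸ 1)))) n ≡ one n)
       × ((n : ℕ) → ∃ λ K → (k : ℕ) → K ≤ k → 3 ≤ k → a k n ≡ catalan n)
       × ((n : ℕ) → (catalanGF ⋆ (one ⊖ (X ⋆ catalanGF))) n ≡ one n)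
mainTheorem3 a size = k≡3 , k≥4 , stable , catalanGF-equation
  where
  a≡levelSize : ∀ k → 3 ≤ k → ∀ n → a k n ≡ levelSize (k ∸ 1) n
  a≡levelSize k 3≤k n = HasSize-InS⇒levelSize k n 3≤k (size k n 3≤k)
  +a≡+levelSize : ∀ k → 3 ≤ k → ∀ n → + a k n ≡ + levelSize (k ∸ 1) n
  +a≡+levelSize k 3≤k n = cong +_ (a≡levelSize k 3≤k n)
  k≡3 : ∀ n → ((λ i → + a 3 i) ⋆ poly (+ 1 ∷ -[1+ 2 ] ∷ + 1 ∷ [])) n ≡ poly (+ 1 ∷ -[1+ 1 ] ∷ []) n
  k≡3 n = trans (⋆-cong {h = poly (+ 1 ∷ -[1+ 2 ] ∷ + 1 ∷ [])} (+a≡+levelSize 3 ≤-refl) (λ _ → refl) n)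
                (levelSize₂-generatingFunction n)
  k≥4 : ∀ k → 4 ≤ k → ∀ n → ((λ i → + a k i) ⋆ (one ⊖ (X ⋆ λ i → + a (k ∸ 1) i))) n ≡ one n
  k≥4 k@(suc (suc (suc (suc e)))) (s≤s 3≤k-1@(s≤s (s≤s (s≤s _)))) n =
    trans (⋆-cong (+a≡+levelSize k (≤-trans 3≤k-1 (n≤1+n _))) (one⊖X⋆-cong (+a≡+levelSize (k ∸ 1) 3≤k-1)) n)
          (levelSize-generatingFunction e n)
  stable : ∀ n → ∃ λ K → ∀ k → K ≤ k → 3 ≤ k → a k n ≡ catalan n
  stable n = 2 + n , λ k 2+n≤k 3≤k →
    trans (a≡levelSize k 3≤k n) (levelSize-catalan (k ∸ 1) n (∸-monoˡ-≤ 1 2+n≤k))
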